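{- Let $m$ be an odd integer such that $q=2m^2-1$ is a prime power. Let $M$ be the $q\times q$ matrix indexed by $\mathbb{F}_q$ with $M_{i,j}=0,1,-1$ according as $j-i$ is $0$, a nonzero square, or a nonsquare of $\mathbb{F}_q$; let $M_1=M+I_q$, $M_2=M-I_q$, $M_3=-M_1$, and \[ N'=\begin{pmatrix}-1 & -\mathbf{1}_q^{\top} & \mathbf{1}_q^{\top}\\ -\mathbf{1}_q & M_1 & M_2\\ \mathbf{1}_q & M_2 & M_3\end{pmatrix}, \] a symmetric $(2q+1)\times(2q+1)$ matrix whose rows and columns are indexed by a set $P$ of size $2q+1$. Let $(P,\mathcal{B})$ be the block design with incidence matrix $(N'+J_{2q+1})/2$ (block $b$ consists of the points $p$ with $N'_{p,b}=1$). Assume there is a $(2m^2-m)$-subset $D$ of $P$ which is a two-intersection set with parameters $(2m^2-m;\{m^2-m,m^2\})$ for $(P,\mathcal{B})$. Then there exists a regular Hadamard matrix of order $n=4m^2$.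
   Context: A $j$-subset $D\subseteq P$ is a $t$-intersection set with parameters $(j;\{\alpha_1,\dots,\alpha_t\})$ for $(P,\mathcal{B})$ if $\{|B\cap D|:B\in\mathcal{B}\}=\{\alpha_1,\dots,\alpha_t\}$. $J_k$ is the $k\times k$ all-one matrix and $\mathbf{1}_k$ the all-one column vector. An Hadamard matrix of order $n$ is an $n\times n$ $\{1,-1\}$-matrix $H$ with $HH^{\top}=nI_n$; it is regular if $H\mathbf{1}_n=r\mathbf{1}_n$ for some positive integer $r$. -}

module Defs where

open import Data.Nat as ℕ using (ℕ; zero; suc; _∸_; _^_)
open import Data.Nat.Primality using (Prime)
open import Data.Integer as ℤ using (ℤ; +_)
open import Data.Fin as Fin using ()
open import Data.Fin using (Fin; zero; suc; splitAt)
open import Data.Fin.Properties using (any?)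
open import Data.Fin.Subset using (Subset; _∩_; ∣_∣)
open import Data.Vec using (tabulate)
open import Data.Sum using (_⊎_; inj₁; inj₂)
open import Data.Product using (Σ; ∃; ∃-syntax; _×_; _,_)
open import Data.List using (List)
open import Data.List.Membership.Propositional using (_∈_)
open import Relation.Nullary using (¬_; Dec; yes; no; does)
open import Relation.Binary.PropositionalEquality using (_≡_)
open import Algebra.Structures using (IsCommutativeRing)

IsPrimePower : ℕ → Set
IsPrimePower q = Σ ℕ λ p → Σ ℕ λ k → Prime p × q ≡ p ^ suc k

Odd : ℕ → Set
Odd m = Σ ℕ λ k → m ≡ suc (2 ℕ.* k)

record FiniteField (q : ℕ) : Set where
  field
    _+_ _*_ : Fin q → Fin q → Fin q
    neg     : Fin q → Fin q
    0# 1#   : Fin q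
    isCommutativeRing : IsCommutativeRing _≡_ _+_ _*_ neg 0# 1#
    0≢1     : ¬ (0# ≡ 1#)
    inverse : ∀ x → ¬ (x ≡ 0#) → Σ (Fin q) λ y → x * y ≡ 1#

  _-_ : Fin q → Fin q → Fin q
  x - y = x + neg y

  _≟F_ : (x y : Fin q) → Dec (x ≡ y)
  _≟F_ = Fin._≟_

  IsNonzeroSquare : Fin q → Set
  IsNonzeroSquare x = ¬ (x ≡ 0#) × ∃[ y ] (y * y ≡ x)

  isSquare? : (x : Fin q) → Dec (∃[ y ] (y * y ≡ x))
  isSquare? x = any? (λ y → (y * y) ≟F x)

  M : Fin q → Fin q → ℤ
  M i j with (j - i) ≟F 0#
  ... | yes _ = + 0
  ... | no _ with isSquare? (j - i)
  ...   | yes _ = + 1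
  ...   | no _  = ℤ.- (+ 1)

  δ : Fin q → Fin q → ℤ
  δ i j with i ≟F j
  ... | yes _ = + 1
  ... | no _  = + 0

  M₁ M₂ M₃ : Fin q → Fin q → ℤ
  M₁ i j = M i j ℤ.+ δ i j
  M₂ i j = M i j ℤ.- δ i j
  M₃ i j = ℤ.- M₁ i j

  -- N' indexed by P = Fin (1 + (q + q)): index zero is the first row/column,
  -- suc (inject i) the second block, suc (raise q i) the third block.
  N' : Fin (suc (q ℕ.+ q)) → Fin (suc (q ℕ.+ q)) → ℤ
  N' zero zero = ℤ.- (+ 1)
  N' zero (suc b) with splitAt q b
  ... | inj₁ _ = ℤ.- (+ 1)
  ... | inj₂ _ = + 1
  N' (suc a) zero with splitAt q a
  ... | inj₁ _ = ℤ.- (+ 1)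
  ... | inj₂ _ = + 1
  N' (suc a) (suc b) with splitAt q a | splitAt q b
  ... | inj₁ i | inj₁ j = M₁ i j
  ... | inj₁ i | inj₂ j = M₂ i j
  ... | inj₂ i | inj₁ j = M₂ i j
  ... | inj₂ i | inj₂ j = M₃ i j

  block : Fin (suc (q ℕ.+ q)) → Subset (suc (q ℕ.+ q))
  block b = tabulate λ p → does (N' p b ℤ.≟ + 1)

IsIntersectionSet : ∀ {v k} → (Fin k → Subset v) → Subset v → ℕ → List ℕ → Set
IsIntersectionSet blocks D j αs =
  ∣ D ∣ ≡ j
  × (∀ b → ∣ blocks b ∩ D ∣ ∈ αs)
  × (∀ α → α ∈ αs → ∃[ b ] (∣ blocks b ∩ D ∣ ≡ α))

kron : (n : ℕ) → Fin n → Fin n → ℤ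
kron n i j with Fin._≟_ i j
... | yes _ = + n
... | no _  = + 0

sumℤ : ∀ {n} → (Fin n → ℤ) → ℤ
sumℤ {zero} f = + 0
sumℤ {suc n} f = f zero ℤ.+ sumℤ (λ i → f (suc i))

IsHadamard : (n : ℕ) → (Fin n → Fin n → ℤ) → Set
IsHadamard n H =
  (∀ i j → H i j ≡ + 1 ⊎ H i j ≡ ℤ.- (+ 1))
  × (∀ i j → sumℤ (λ k → H i k ℤ.* H j k)
               ≡ kron n i j)

IsRegularHadamard : (n : ℕ) → (Fin n → Fin n → ℤ) → Set
IsRegularHadamard n H =
  IsHadamard n H × Σ ℕ λ r → (0 ℕ.< r) × (∀ i → sumℤ (H i) ≡ + r)

module Submission where

-- Write q = 2m² − 1 and let K be N' bordered by a first row and column of ones.  Since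
-- m is odd, q ≡ 1 (mod 4), so −1 is a square in F_q and the Paley matrix M is symmetric
-- with M·1 = 0 and M Mᵀ = qI − J; expanding the blocks of N' then gives N'·1 = −1 and
-- N' N'ᵀ = (2q + 2)I − J, which says exactly that K is a Hadamard matrix of order
-- 2q + 2 = 4m².  Negating the columns of K indexed by D and the rows whose block meets D
-- in m² points keeps K Hadamard; as |D| = 2m² − m and every block meets D in m² − m or
-- m² points, all row sums of the result equal 2m.

open import Algebra.Bundles using (CommutativeRing)
open import Data.Nat as ℕ using (ℕ)
open import Defs
open import Relation.Binary.PropositionalEquality using (_≡_)

-- Constants are interpreted along ℤ → R, so that the normaliser can compute with them
-- (1 − 1 = 0); with the elements of an abstract ring as coefficients it could not.
module IntegerCoefficients {c ℓ} (R : CommutativeRing c ℓ) where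

  open import Algebra.Solver.Ring.AlmostCommutativeRing
    using (fromCommutativeRing; _-Raw-AlmostCommutative⟶_)
  open import Data.Integer as ℤ using (ℤ; +_; -[1+_])
  import Data.Integer.Properties as ℤ
  open import Data.Maybe using (Maybe; just; nothing)
  open import Data.Nat as ℕ using (ℕ; zero; suc)
  import Data.Nat.Properties as ℕ
  import Relation.Binary.PropositionalEquality as ≡
  open import Relation.Nullary using (yes; no)

  open CommutativeRing R
  open import Algebra.Properties.Ring ring using (-‿involutive; -0#≈0#; -‿distribʳ-*)
  open import Algebra.Properties.AbelianGroup +-abelianGroup using (⁻¹-∙-comm)
  open import Algebra.Properties.Semiring.Mult.TCOptimised semiring using (_×_; 1+×; ×-homo-+)
  open import Relation.Binary.Reasoning.Setoid setoid

  fromℤ : ℤ → Carrier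
  fromℤ (+ n)      = n × 1#
  fromℤ (-[1+ n ]) = - (suc n × 1#)

  private
    fromℤ-⊖ : ∀ m n → fromℤ (m ℤ.⊖ n) ≈ m × 1# - n × 1#
    fromℤ-⊖ m       zero    = sym (trans (+-congˡ -0#≈0#) (+-identityʳ _))
    fromℤ-⊖ zero    (suc n) = sym (+-identityˡ _)
    fromℤ-⊖ (suc m) (suc n) = begin
      fromℤ (suc m ℤ.⊖ suc n)           ≡⟨ ≡.cong fromℤ (ℤ.[1+m]⊖[1+n]≡m⊖n m n) ⟩
      fromℤ (m ℤ.⊖ n)                   ≈⟨ fromℤ-⊖ m n ⟩
      m × 1# - n × 1#                   ≈⟨ cancel (m × 1#) (n × 1#) ⟨
      (1# + m × 1#) - (1# + n × 1#)     ≈⟨ +-cong (1+× m 1#) (-‿cong (1+× n 1#)) ⟨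
      suc m × 1# - suc n × 1#           ∎
      where
      cancel : ∀ a b → (1# + a) - (1# + b) ≈ a - b
      cancel a b = begin
        (1# + a) + - (1# + b)     ≈⟨ +-congˡ (sym (⁻¹-∙-comm 1# b)) ⟩
        (1# + a) + (- 1# + - b)   ≈⟨ +-congʳ (+-comm 1# a) ⟩
        (a + 1#) + (- 1# + - b)   ≈⟨ +-assoc a 1# _ ⟩
        a + (1# + (- 1# + - b))   ≈⟨ +-congˡ (sym (+-assoc 1# (- 1#) (- b))) ⟩
        a + ((1# + - 1#) + - b)   ≈⟨ +-congˡ (+-congʳ (-‿inverseʳ 1#)) ⟩
        a + (0# + - b)            ≈⟨ +-congˡ (+-identityˡ _) ⟩
        a - b                     ∎

  fromℤ-homo-+ : ∀ i j → fromℤ (i ℤ.+ j) ≈ fromℤ i + fromℤ j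
  fromℤ-homo-+ (+ m)    (+ n)    = ×-homo-+ 1# m n
  fromℤ-homo-+ (+ m)    -[1+ n ] = fromℤ-⊖ m (suc n)
  fromℤ-homo-+ -[1+ m ] (+ n)    = trans (fromℤ-⊖ n (suc m)) (+-comm _ _)
  fromℤ-homo-+ -[1+ m ] -[1+ n ] = begin
    - (suc (suc (m ℕ.+ n)) × 1#)            ≡⟨ ≡.cong (λ k → - (suc k × 1#)) (ℕ.+-suc m n) ⟨
    - ((suc m ℕ.+ suc n) × 1#)              ≈⟨ -‿cong (×-homo-+ 1# (suc m) (suc n)) ⟩
    - (suc m × 1# + suc n × 1#)             ≈⟨ ⁻¹-∙-comm _ _ ⟨
    - (suc m × 1#) + - (suc n × 1#)         ∎

  fromℤ-homo-‿ : ∀ i → fromℤ (ℤ.- i) ≈ - fromℤ i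
  fromℤ-homo-‿ (+ zero)  = sym -0#≈0#
  fromℤ-homo-‿ (+ suc n) = refl
  fromℤ-homo-‿ -[1+ n ]  = sym (-‿involutive _)

  private
    fromℤ-homo-*-+ : ∀ i n → fromℤ (i ℤ.* + n) ≈ fromℤ i * (n × 1#)
    fromℤ-homo-*-+ i zero    = trans (reflexive (≡.cong fromℤ (ℤ.*-zeroʳ i))) (sym (zeroʳ _))
    fromℤ-homo-*-+ i (suc n) = begin
      fromℤ (i ℤ.* + suc n)                ≡⟨ ≡.cong fromℤ (ℤ.*-suc i (+ n)) ⟩
      fromℤ (i ℤ.+ i ℤ.* + n)              ≈⟨ fromℤ-homo-+ i _ ⟩
      fromℤ i + fromℤ (i ℤ.* + n)          ≈⟨ +-cong (sym (*-identityʳ _)) (fromℤ-homo-*-+ i n) ⟩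
      fromℤ i * 1# + fromℤ i * (n × 1#)    ≈⟨ distribˡ _ _ _ ⟨
      fromℤ i * (1# + n × 1#)              ≈⟨ *-congˡ (1+× n 1#) ⟨
      fromℤ i * (suc n × 1#)               ∎

  fromℤ-homo-* : ∀ i j → fromℤ (i ℤ.* j) ≈ fromℤ i * fromℤ j
  fromℤ-homo-* i (+ n)    = fromℤ-homo-*-+ i n
  fromℤ-homo-* i -[1+ n ] = begin
    fromℤ (i ℤ.* -[1+ n ])               ≡⟨ ≡.cong fromℤ (ℤ.neg-distribʳ-* i (+ suc n)) ⟨
    fromℤ (ℤ.- (i ℤ.* + suc n))          ≈⟨ fromℤ-homo-‿ (i ℤ.* + suc n) ⟩
    - fromℤ (i ℤ.* + suc n)              ≈⟨ -‿cong (fromℤ-homo-*-+ i (suc n)) ⟩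
    - (fromℤ i * (suc n × 1#))           ≈⟨ -‿distribʳ-* _ _ ⟩
    fromℤ i * - (suc n × 1#)             ∎

  homomorphism : ℤ.+-*-rawRing -Raw-AlmostCommutative⟶ fromCommutativeRing R
  homomorphism = record
    { ⟦_⟧    = fromℤ
    ; +-homo = fromℤ-homo-+
    ; *-homo = fromℤ-homo-*
    ; -‿homo = fromℤ-homo-‿
    ; 0-homo = refl
    ; 1-homo = refl
    }

  private
    _≟fromℤ_ : ∀ i j → Maybe (fromℤ i ≈ fromℤ j)
    i ≟fromℤ j with i ℤ.≟ j
    ... | yes i≡j = just (reflexive (≡.cong fromℤ i≡j))
    ... | no _    = nothing

  open import Algebra.Solver.Ring ℤ.+-*-rawRing (fromCommutativeRing R) homomorphism _≟fromℤ_
    public using (solve; _:=_; con; _:+_; _:*_; _:-_; :-_)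

module FiniteSums where

  open import Data.Bool using (Bool; true; false; _∧_)
  open import Data.Fin using (Fin; zero; suc; _↑ˡ_; _↑ʳ_; punchIn)
  open import Data.Fin.Permutation using (permutation)
  import Data.Fin.Properties as Fin
  open import Data.Integer using (ℤ; +_; _+_; _-_; _*_; -_; 0ℤ; 1ℤ)
  import Data.Integer.Properties as ℤ
  open import Data.Nat as ℕ using (ℕ; zero; suc)
  open import Data.Vec using ([]; _∷_; lookup)
  open import Data.Fin.Subset using (Subset; ∣_∣)
  open import Function using (_∘_)
  open import Relation.Binary.PropositionalEquality
  open import Relation.Nullary using (Dec; does; yes; no)
  open import Relation.Nullary.Decidable using (dec-true; dec-false)

  open import Algebra.Properties.Semiring.Sum ℤ.+-*-semiring public
    using (sum; sum-cong-≗; ∑-distrib-+; ∑-comm; *-distribˡ-sum; *-distribʳ-sum)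
  open import Algebra.Properties.Semiring.Sum ℤ.+-*-semiring
    using (sum-remove; sum-permute; sum-replicate-zero)

  private variable
    m n : ℕ

  sumℤ≡sum : (f : Fin n → ℤ) → sumℤ f ≡ sum f
  sumℤ≡sum {zero}  f = refl
  sumℤ≡sum {suc n} f = cong (_+_ (f zero)) (sumℤ≡sum (f ∘ suc))

  sum-const : ∀ n (c : ℤ) → sum {n} (λ _ → c) ≡ + n * c
  sum-const zero    c = sym (ℤ.*-zeroˡ c)
  sum-const (suc n) c = begin
    c + sum {n} (λ _ → c)    ≡⟨ cong (_+_ c) (sum-const n c) ⟩
    c + + n * c              ≡⟨ cong (_+ + n * c) (ℤ.*-identityˡ c) ⟨
    1ℤ * c + + n * c         ≡⟨ ℤ.*-distribʳ-+ c 1ℤ (+ n) ⟨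
    + suc n * c              ∎
    where open ≡-Reasoning

  sum-zero : (f : Fin n → ℤ) → (∀ i → f i ≡ 0ℤ) → sum f ≡ 0ℤ
  sum-zero {n} f f≡0 = trans (sum-cong-≗ f≡0) (trans (sum-const n 0ℤ) (ℤ.*-zeroʳ (+ n)))

  sum-ones : ∀ n → sum {n} (λ _ → 1ℤ) ≡ + n
  sum-ones n = trans (sum-const n 1ℤ) (ℤ.*-identityʳ (+ n))

  sum-neg : (f : Fin n → ℤ) → sum (-_ ∘ f) ≡ - sum f
  sum-neg {zero}  f = refl
  sum-neg {suc n} f = trans (cong (_+_ (- f zero)) (sum-neg (f ∘ suc))) (sym (ℤ.neg-distrib-+ (f zero) _))

  sum-distrib-- : (f g : Fin n → ℤ) → sum (λ i → f i - g i) ≡ sum f - sum g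
  sum-distrib-- f g = trans (∑-distrib-+ f (-_ ∘ g)) (cong (_+_ (sum f)) (sum-neg g))

  sum-*-sum : (f : Fin m → ℤ) (g : Fin n → ℤ) → sum f * sum g ≡ sum (λ i → sum (λ j → f i * g j))
  sum-*-sum f g = trans (*-distribʳ-sum (sum g) f) (sum-cong-≗ (λ i → *-distribˡ-sum (f i) g))

  sum-linear : ∀ a b (f g : Fin n → ℤ) → sum (λ i → a * f i + b * g i) ≡ a * sum f + b * sum g
  sum-linear a b f g = trans (∑-distrib-+ (λ i → a * f i) (λ i → b * g i))
                             (sym (cong₂ _+_ (*-distribˡ-sum a f) (*-distribˡ-sum b g)))

  sum-point : (f : Fin n → ℤ) (c : Fin n) → (∀ i → i ≢ c → f i ≡ 0ℤ) → sum f ≡ f c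
  sum-point {suc n} f c vanish = begin
    sum f                               ≡⟨ sum-remove f ⟩
    f c + sum (λ j → f (punchIn c j))   ≡⟨ cong (_+_ (f c)) (sum-cong-≗ (λ j → vanish _ (Fin.punchInᵢ≢i c j))) ⟩
    f c + sum {n} (λ _ → 0ℤ)            ≡⟨ cong (_+_ (f c)) (sum-replicate-zero n) ⟩
    f c + 0ℤ                            ≡⟨ ℤ.+-identityʳ (f c) ⟩
    f c                                 ∎
    where open ≡-Reasoning

  sum-reindex : (σ τ : Fin n → Fin n) → (∀ i → σ (τ i) ≡ i) → (∀ i → τ (σ i) ≡ i) →
                (f : Fin n → ℤ) → sum (f ∘ σ) ≡ sum f
  sum-reindex σ τ στ τσ f = sym (sum-permute f (permutation σ τ στ τσ))

  sum-split : (f : Fin (m ℕ.+ n) → ℤ) → sum f ≡ sum (f ∘ (_↑ˡ n)) + sum (f ∘ (m ↑ʳ_))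
  sum-split {zero}  f = sym (ℤ.+-identityˡ (sum f))
  sum-split {suc m} f = trans (cong (_+_ (f zero)) (sum-split {m} (f ∘ suc))) (sym (ℤ.+-assoc (f zero) _ _))

  𝟙 : Bool → ℤ
  𝟙 true  = 1ℤ
  𝟙 false = 0ℤ

  𝟙-∧ : ∀ x y → 𝟙 (x ∧ y) ≡ 𝟙 x * 𝟙 y
  𝟙-∧ true  true  = refl
  𝟙-∧ true  false = refl
  𝟙-∧ false y     = refl

  card≡sum : (S : Subset n) → + ∣ S ∣ ≡ sum (𝟙 ∘ lookup S)
  card≡sum []          = refl
  card≡sum (true ∷ S)  = cong (_+_ 1ℤ) (card≡sum S)
  card≡sum (false ∷ S) = trans (card≡sum S) (sym (ℤ.+-identityˡ _))

  𝟙-cong : ∀ {p q} {P : Set p} {Q : Set q} (P? : Dec P) (Q? : Dec Q) →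
           (P → Q) → (Q → P) → 𝟙 (does P?) ≡ 𝟙 (does Q?)
  𝟙-cong (yes p) Q? p→q q→p = cong 𝟙 (sym (dec-true Q? (p→q p)))
  𝟙-cong (no ¬p) Q? p→q q→p = cong 𝟙 (sym (dec-false Q? (¬p ∘ q→p)))

  count-≡ : (c : Fin n) → sum (λ i → 𝟙 (does (i Fin.≟ c))) ≡ 1ℤ
  count-≡ c = trans (sum-point _ c (λ i i≢c → cong 𝟙 (dec-false (i Fin.≟ c) i≢c))) (cong 𝟙 (dec-true (c Fin.≟ c) refl))

module Parity where

  open FiniteSums
  open import Data.Bool using (Bool; true; false; _∧_)
  open import Data.Fin using (Fin; _<_)
  import Data.Fin.Properties as Fin
  open import Data.Integer using (ℤ; +_; _+_; _*_; 1ℤ)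
  open import Data.Integer.Divisibility.Signed using (_∣_; divides; ∣m+n∣n⇒∣m; ∣⇒∣ᵤ)
  open import Data.Integer.Tactic.RingSolver using (solve-∀)
  open import Data.Nat.Divisibility using (∣1⇒≡1)
  open import Data.Product using (Σ; _,_)
  open import Function using (_∘_)
  open import Relation.Binary using (tri<; tri≈; tri>)
  open import Relation.Binary.PropositionalEquality
  open import Relation.Nullary using (¬_; does; yes; no)
  open import Relation.Nullary.Decidable using (dec-true; dec-false)
  open import Relation.Unary using (Pred; Decidable)

  odd≢even : ∀ a b → 1ℤ + (a + a) ≢ b + b
  odd≢even a b odd≡even = 2≢1 (∣1⇒≡1 (∣⇒∣ᵤ 2∣1))
    where
    2≢1 : ¬ 2 ≡ 1
    2≢1 ()
    twice : ∀ x → x + x ≡ x * + 2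
    twice = solve-∀
    2∣1 : + 2 ∣ 1ℤ
    2∣1 = ∣m+n∣n⇒∣m (subst (+ 2 ∣_) (sym odd≡even) (divides b (twice b))) (divides a (twice a))

  -- P is σ-invariant, so σ pairs off the elements of P that it moves; each such pair
  -- {i, σ i} is counted once by `below` and once by `above`.
  module _ {n} (σ : Fin n → Fin n) (σ-involutive : ∀ i → σ (σ i) ≡ i)
           {p} {P : Pred (Fin n) p} (P? : Decidable P) (P-closed : ∀ i → P (σ i) → P i) where

    private
      fixed below above : Fin n → Bool
      fixed i = does (P? i) ∧ does (i Fin.≟ σ i)
      below i = does (P? i) ∧ does (i Fin.<? σ i)
      above i = does (P? i) ∧ does (σ i Fin.<? i)

      P-invariant : ∀ i → does (P? (σ i)) ≡ does (P? i)
      P-invariant i with P? i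
      ... | yes Pi = dec-true (P? (σ i)) (P-closed (σ i) (subst P (sym (σ-involutive i)) Pi))
      ... | no ¬Pi = dec-false (P? (σ i)) (¬Pi ∘ P-closed i)

      trichotomy : ∀ i → 𝟙 (does (P? i)) ≡ 𝟙 (fixed i) + (𝟙 (below i) + 𝟙 (above i))
      trichotomy i with does (P? i)
      ... | false = refl
      ... | true with Fin.<-cmp i (σ i)
      ...   | tri< i<σi i≢σi _ rewrite dec-false (i Fin.≟ σ i) i≢σi | dec-true (i Fin.<? σ i) i<σi
                                     | dec-false (σ i Fin.<? i) (Fin.<-asym i<σi) = refl
      ...   | tri≈ _ i≡σi _ rewrite dec-true (i Fin.≟ σ i) i≡σi | dec-false (i Fin.<? σ i) (Fin.<-irrefl i≡σi)
                                     | dec-false (σ i Fin.<? i) (Fin.<-irrefl (sym i≡σi)) = refl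
      ...   | tri> _ i≢σi σi<i rewrite dec-false (i Fin.≟ σ i) i≢σi | dec-false (i Fin.<? σ i) (Fin.<-asym σi<i)
                                     | dec-true (σ i Fin.<? i) σi<i = refl

      above∘σ : ∀ i → above (σ i) ≡ below i
      above∘σ i rewrite P-invariant i | σ-involutive i = refl

    count-by-involution : Σ ℤ λ e → sum (λ i → 𝟙 (does (P? i))) ≡ sum (𝟙 ∘ fixed) + (e + e)
    count-by-involution = sum (𝟙 ∘ below) , (begin
      sum (λ i → 𝟙 (does (P? i)))                            ≡⟨ sum-cong-≗ trichotomy ⟩
      sum (λ i → 𝟙 (fixed i) + (𝟙 (below i) + 𝟙 (above i)))  ≡⟨ ∑-distrib-+ (𝟙 ∘ fixed) _ ⟩
      sum (𝟙 ∘ fixed) + sum (λ i → 𝟙 (below i) + 𝟙 (above i)) ≡⟨ cong (_+_ (sum (𝟙 ∘ fixed))) (∑-distrib-+ (𝟙 ∘ below) (𝟙 ∘ above)) ⟩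
      sum (𝟙 ∘ fixed) + (sum (𝟙 ∘ below) + sum (𝟙 ∘ above))  ≡⟨ cong (λ s → sum (𝟙 ∘ fixed) + (sum (𝟙 ∘ below) + s)) above≡below ⟩
      sum (𝟙 ∘ fixed) + (sum (𝟙 ∘ below) + sum (𝟙 ∘ below))  ∎)
      where
      open ≡-Reasoning
      above≡below : sum (𝟙 ∘ above) ≡ sum (𝟙 ∘ below)
      above≡below = trans (sym (sum-reindex σ σ σ-involutive σ-involutive (𝟙 ∘ above))) (sum-cong-≗ (cong 𝟙 ∘ above∘σ))

module FiniteFieldProperties {q} (F : FiniteField q) where

  open FiniteSums
  open Parity
  open import Data.Bool using (_∧_)
  open import Data.Empty using (⊥-elim)
  open import Data.Fin using (Fin)
  open import Data.Integer as ℤ using (ℤ; +_; 0ℤ; 1ℤ; -1ℤ)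
  import Data.Integer.Properties as ℤ
  open import Data.Integer.Tactic.RingSolver using (solve-∀)
  open import Data.Nat as ℕ using (ℕ; suc)
  open import Data.Product using (∃-syntax; _,_; proj₁; proj₂)
  open import Data.Sum using (_⊎_; inj₁; inj₂; [_,_])
  open import Data.Unit using (⊤; tt)
  open import Function using (_∘_)
  open import Level using (0ℓ)
  open import Relation.Binary.PropositionalEquality
    using (_≡_; _≢_; refl; sym; trans; cong; cong₂; subst; module ≡-Reasoning)
  open import Relation.Nullary using (Dec; does; yes; no)
  open import Relation.Nullary.Decidable using (dec-true; dec-false)

  open FiniteField F using (isCommutativeRing; 0≢1; inverse; _≟F_; isSquare?; IsNonzeroSquare; δ)

  ring : CommutativeRing 0ℓ 0ℓ
  ring = record { isCommutativeRing = isCommutativeRing }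

  open CommutativeRing ring
    using (_+_; _*_; -_; _-_; 0#; 1#; *-comm; *-identityˡ; *-identityʳ; zeroˡ; zeroʳ;
           +-identityˡ; -‿inverseʳ; *-assoc)
  open IntegerCoefficients ring using (solve; _:=_; con; _:+_; _:*_; _:-_; :-_)

  infix 4 _≟_
  _≟_ : (x y : Fin q) → Dec (x ≡ y)
  _≟_ = _≟F_

  x-y≡0⇒x≡y : ∀ {x y} → x - y ≡ 0# → x ≡ y
  x-y≡0⇒x≡y {x} {y} x-y≡0 = begin
    x              ≡⟨ solve 2 (λ x y → x := (x :- y) :+ y) refl x y ⟩
    (x - y) + y    ≡⟨ cong (_+ y) x-y≡0 ⟩
    0# + y         ≡⟨ +-identityˡ y ⟩
    y              ∎
    where open ≡-Reasoning

  +-cancelˡ : ∀ a {x y} → a + x ≡ a + y → x ≡ y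
  +-cancelˡ a {x} {y} eq = x-y≡0⇒x≡y (begin
    x - y                ≡⟨ solve 3 (λ a x y → x :- y := (a :+ x) :- (a :+ y)) refl a x y ⟩
    (a + x) - (a + y)    ≡⟨ cong (_- (a + y)) eq ⟩
    (a + y) - (a + y)    ≡⟨ -‿inverseʳ (a + y) ⟩
    0#                   ∎)
    where open ≡-Reasoning

  inv : Fin q → Fin q
  inv x with x ≟F 0#
  ... | yes _  = 0#
  ... | no x≢0 = proj₁ (inverse x x≢0)

  *-inverseʳ : ∀ {x} → x ≢ 0# → x * inv x ≡ 1#
  *-inverseʳ {x} x≢0 with x ≟F 0#
  ... | yes x≡0 = ⊥-elim (x≢0 x≡0)
  ... | no x≢0  = proj₂ (inverse x x≢0)

  *-inverseˡ : ∀ {x} → x ≢ 0# → inv x * x ≡ 1#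
  *-inverseˡ {x} x≢0 = trans (*-comm (inv x) x) (*-inverseʳ x≢0)

  inv-*-cancelˡ : ∀ {a} → a ≢ 0# → ∀ x → inv a * (a * x) ≡ x
  inv-*-cancelˡ {a} a≢0 x = begin
    inv a * (a * x)    ≡⟨ *-assoc (inv a) a x ⟨
    (inv a * a) * x    ≡⟨ cong (_* x) (*-inverseˡ a≢0) ⟩
    1# * x             ≡⟨ *-identityˡ x ⟩
    x                  ∎
    where open ≡-Reasoning

  *-cancelˡ : ∀ {a} → a ≢ 0# → ∀ {x y} → a * x ≡ a * y → x ≡ y
  *-cancelˡ {a} a≢0 {x} {y} eq = begin
    x                  ≡⟨ inv-*-cancelˡ a≢0 x ⟨
    inv a * (a * x)    ≡⟨ cong (inv a *_) eq ⟩
    inv a * (a * y)    ≡⟨ inv-*-cancelˡ a≢0 y ⟩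
    y                  ∎
    where open ≡-Reasoning

  x*y≡0⇒x≡0⊎y≡0 : ∀ x y → x * y ≡ 0# → x ≡ 0# ⊎ y ≡ 0#
  x*y≡0⇒x≡0⊎y≡0 x y xy≡0 with x ≟F 0#
  ... | yes x≡0 = inj₁ x≡0
  ... | no x≢0  = inj₂ (*-cancelˡ x≢0 (trans xy≡0 (sym (zeroʳ x))))

  inv-0 : inv 0# ≡ 0#
  inv-0 with 0# ≟F 0#
  ... | yes _   = refl
  ... | no 0≢0 = ⊥-elim (0≢0 refl)

  inv-nonzero : ∀ {x} → x ≢ 0# → inv x ≢ 0#
  inv-nonzero {x} x≢0 inv≡0 = 0≢1 (begin
    0#           ≡⟨ zeroʳ x ⟨
    x * 0#       ≡⟨ cong (x *_) inv≡0 ⟨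
    x * inv x    ≡⟨ *-inverseʳ x≢0 ⟩
    1#           ∎)
    where open ≡-Reasoning

  inv-involutive : ∀ x → inv (inv x) ≡ x
  inv-involutive x = cases (x ≟F 0#)
    where
    cases : Dec (x ≡ 0#) → inv (inv x) ≡ x
    cases (yes refl) = trans (cong inv inv-0) inv-0
    cases (no x≢0)   = *-cancelˡ (inv-nonzero x≢0) (trans (*-inverseʳ (inv-nonzero x≢0)) (sym (*-inverseˡ x≢0)))

  x²≢0 : ∀ {x} → x ≢ 0# → x * x ≢ 0#
  x²≢0 x≢0 x²≡0 with x*y≡0⇒x≡0⊎y≡0 _ _ x²≡0
  ... | inj₁ x≡0 = x≢0 x≡0
  ... | inj₂ x≡0 = x≢0 x≡0

  x²≡y²⇒x≡±y : ∀ {x y} → x * x ≡ y * y → x ≡ y ⊎ x ≡ - y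
  x²≡y²⇒x≡±y {x} {y} x²≡y² with x*y≡0⇒x≡0⊎y≡0 (x - y) (x + y) (begin
      (x - y) * (x + y)    ≡⟨ solve 2 (λ x y → (x :- y) :* (x :+ y) := x :* x :- y :* y) refl x y ⟩
      x * x - y * y        ≡⟨ cong (_- (y * y)) x²≡y² ⟩
      y * y - y * y        ≡⟨ -‿inverseʳ (y * y) ⟩
      0#                   ∎)
    where open ≡-Reasoning
  ... | inj₁ x-y≡0 = inj₁ (x-y≡0⇒x≡y x-y≡0)
  ... | inj₂ x+y≡0 = inj₂ (x-y≡0⇒x≡y (trans (solve 2 (λ x y → x :- :- y := x :+ y) refl x y) x+y≡0))

  -- If 1 + 1 = 0 then x ↦ x + 1 is an involution without fixed points, so q is even.
  odd-order⇒1+1≢0 : ∀ k → q ≡ suc (k ℕ.+ k) → 1# + 1# ≢ 0#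
  odd-order⇒1+1≢0 k q≡1+2k 1+1≡0 =
    let e , q≡fixed+2e = count-by-involution σ σ-involutive {P = λ _ → ⊤} (λ _ → yes tt) (λ _ _ → tt)
    in odd≢even (+ k) e (begin
    + suc (k ℕ.+ k)                                  ≡⟨ cong +_ q≡1+2k ⟨
    + q                                              ≡⟨ trans (sum-const q 1ℤ) (ℤ.*-identityʳ (+ q)) ⟨
    sum {q} (λ _ → 1ℤ)                               ≡⟨ q≡fixed+2e ⟩
    sum (λ i → 𝟙 (does (i ≟ σ i))) ℤ.+ (e ℤ.+ e)   ≡⟨ cong (ℤ._+ (e ℤ.+ e)) (sum-zero _ no-fixed-point) ⟩
    0ℤ ℤ.+ (e ℤ.+ e)                                 ≡⟨ ℤ.+-identityˡ (e ℤ.+ e) ⟩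
    e ℤ.+ e                                          ∎)
    where
    open ≡-Reasoning
    σ : Fin q → Fin q
    σ x = x + 1#
    σ-involutive : ∀ x → σ (σ x) ≡ x
    σ-involutive x = begin
      (x + 1#) + 1#     ≡⟨ solve 2 (λ x o → (x :+ o) :+ o := x :+ (o :+ o)) refl x 1# ⟩
      x + (1# + 1#)     ≡⟨ cong (_+_ x) 1+1≡0 ⟩
      x + 0#            ≡⟨ solve 1 (λ x → x :+ con 0ℤ := x) refl x ⟩
      x                 ∎
    no-fixed-point : ∀ x → 𝟙 (does (x ≟ σ x)) ≡ 0ℤ
    no-fixed-point x = cong 𝟙 (dec-false (x ≟ σ x)
      (λ x≡x+1 → 0≢1 (+-cancelˡ x (trans (solve 1 (λ x → x :+ con 0ℤ := x) refl x) x≡x+1))))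

  count-affine : ∀ {a} → a ≢ 0# → ∀ b c → sum (λ y → 𝟙 (does (a * y + b ≟ c))) ≡ 1ℤ
  count-affine {a} a≢0 b c = begin
    sum (λ y → 𝟙 (does (a * y + b ≟ c)))   ≡⟨ sum-cong-≗ (λ y → 𝟙-cong (a * y + b ≟ c) (y ≟ y₀) solution-unique solution) ⟩
    sum (λ y → 𝟙 (does (y ≟ y₀)))           ≡⟨ count-≡ y₀ ⟩
    1ℤ                                         ∎
    where
    open ≡-Reasoning
    y₀ : Fin q
    y₀ = inv a * (c - b)
    solution : ∀ {y} → y ≡ y₀ → a * y + b ≡ c
    solution refl = begin
      a * (inv a * (c - b)) + b     ≡⟨ cong (_+ b) (*-assoc a (inv a) (c - b)) ⟨
      (a * inv a) * (c - b) + b     ≡⟨ cong (λ u → u * (c - b) + b) (*-inverseʳ a≢0) ⟩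
      1# * (c - b) + b              ≡⟨ solve 2 (λ b c → con 1ℤ :* (c :- b) :+ b := c) refl b c ⟩
      c                             ∎
    solution-unique : ∀ {y} → a * y + b ≡ c → y ≡ y₀
    solution-unique {y} ay+b≡c = begin
      y                    ≡⟨ inv-*-cancelˡ a≢0 y ⟨
      inv a * (a * y)      ≡⟨ cong (inv a *_) (solve 3 (λ a y b → a :* y := (a :* y :+ b) :- b) refl a y b) ⟩
      inv a * ((a * y + b) - b) ≡⟨ cong (λ u → inv a * (u - b)) ay+b≡c ⟩
      y₀                   ∎

  count-translate : ∀ c i → sum (λ k → 𝟙 (does (c ≟ k - i))) ≡ 1ℤ
  count-translate c i = begin
    sum (λ k → 𝟙 (does (c ≟ k - i)))                  ≡⟨ sum-cong-≗ (λ k → 𝟙-cong (c ≟ k - i) (1# * k + - i ≟ c) to from) ⟩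
    sum (λ k → 𝟙 (does (1# * k + - i ≟ c)))           ≡⟨ count-affine (0≢1 ∘ sym) (- i) c ⟩
    1ℤ                                                  ∎
    where
    open ≡-Reasoning
    to : ∀ {k} → c ≡ k - i → 1# * k + - i ≡ c
    to {k} c≡k-i = trans (cong (_+ - i) (*-identityˡ k)) (sym c≡k-i)
    from : ∀ {k} → 1# * k + - i ≡ c → c ≡ k - i
    from {k} eq = trans (sym eq) (cong (_+ - i) (*-identityˡ k))

  δ-refl : ∀ i → δ i i ≡ 1ℤ
  δ-refl i with i ≟F i
  ... | yes _   = refl
  ... | no i≢i = ⊥-elim (i≢i refl)

  δ-≢ : ∀ {i j} → i ≢ j → δ i j ≡ 0ℤ
  δ-≢ {i} {j} i≢j with i ≟F j
  ... | yes i≡j = ⊥-elim (i≢j i≡j)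
  ... | no _    = refl

  δ-symmetric : ∀ i j → δ i j ≡ δ j i
  δ-symmetric i j with i ≟F j | j ≟F i
  ... | yes _   | yes _   = refl
  ... | no _    | no _    = refl
  ... | yes i≡j | no j≢i  = ⊥-elim (j≢i (sym i≡j))
  ... | no i≢j  | yes j≡i = ⊥-elim (i≢j (sym j≡i))

  sum-δ-* : ∀ i (f : Fin q → ℤ) → sum (λ k → δ i k ℤ.* f k) ≡ f i
  sum-δ-* i f = trans (sum-point _ i (λ k k≢i → cong (ℤ._* f k) (δ-≢ (k≢i ∘ sym))))
                      (trans (cong (ℤ._* f i) (δ-refl i)) (ℤ.*-identityˡ (f i)))

  sum-*-δ : ∀ j (f : Fin q → ℤ) → sum (λ k → f k ℤ.* δ j k) ≡ f j
  sum-*-δ j f = trans (sum-cong-≗ (λ k → ℤ.*-comm (f k) (δ j k))) (sum-δ-* j f)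

  sum-δ : ∀ i → sum (δ i) ≡ 1ℤ
  sum-δ i = trans (sum-cong-≗ (λ k → sym (ℤ.*-identityʳ (δ i k)))) (sum-δ-* i (λ _ → 1ℤ))

  χ : Fin q → ℤ
  χ x with x ≟F 0#
  ... | yes _ = 0ℤ
  ... | no _ with isSquare? x
  ...   | yes _ = 1ℤ
  ...   | no _  = -1ℤ

  roots : Fin q → ℤ
  roots x = sum (λ y → 𝟙 (does (y * y ≟ x)))

  χ-0 : χ 0# ≡ 0ℤ
  χ-0 with 0# ≟F 0#
  ... | yes _   = refl
  ... | no 0≢0 = ⊥-elim (0≢0 refl)

  χ-nonzero : ∀ {x} → x ≢ 0# → χ x ≡ 1ℤ ⊎ χ x ≡ -1ℤ
  χ-nonzero {x} x≢0 with x ≟F 0#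
  ... | yes x≡0 = ⊥-elim (x≢0 x≡0)
  ... | no _ with isSquare? x
  ...   | yes _ = inj₁ refl
  ...   | no _  = inj₂ refl

  sum-roots-translate : ∀ i → sum (λ k → roots (k - i)) ≡ + q
  sum-roots-translate i = begin
    sum (λ k → sum (λ y → 𝟙 (does (y * y ≟ k - i))))   ≡⟨ ∑-comm (λ k y → 𝟙 (does (y * y ≟ k - i))) ⟩
    sum (λ y → sum (λ k → 𝟙 (does (y * y ≟ k - i))))   ≡⟨ sum-cong-≗ (λ y → count-translate (y * y) i) ⟩
    sum {q} (λ _ → 1ℤ)                                   ≡⟨ sum-ones q ⟩
    + q                                                  ∎
    where open ≡-Reasoning

  square-difference : ∀ y u c → (y + u) * (y + u) ≡ y * y + c → (u + u) * y + u * u ≡ c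
  square-difference y u c eq = +-cancelˡ (y * y)
    (trans (solve 2 (λ y u → y :* y :+ ((u :+ u) :* y :+ u :* u) := (y :+ u) :* (y :+ u)) refl y u) eq)

  square-difference⁻¹ : ∀ y u c → (u + u) * y + u * u ≡ c → (y + u) * (y + u) ≡ y * y + c
  square-difference⁻¹ y u c eq =
    trans (solve 2 (λ y u → (y :+ u) :* (y :+ u) := y :* y :+ ((u :+ u) :* y :+ u :* u)) refl y u) (cong (_+_ (y * y)) eq)

  χ² : ∀ x → χ x ℤ.* χ x ≡ 1ℤ ℤ.- 𝟙 (does (0# ≟ x))
  χ² x with x ≟F 0#
  ... | yes refl = cong (λ b → 1ℤ ℤ.- 𝟙 b) (sym (dec-true (0# ≟ 0#) refl))
  ... | no x≢0 with isSquare? x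
  ...   | yes _ = cong (λ b → 1ℤ ℤ.- 𝟙 b) (sym (dec-false (0# ≟ x) (x≢0 ∘ sym)))
  ...   | no _  = cong (λ b → 1ℤ ℤ.- 𝟙 b) (sym (dec-false (0# ≟ x) (x≢0 ∘ sym)))

  sum-χ²-translate : ∀ i → sum (λ k → χ (k - i) ℤ.* χ (k - i)) ≡ + q ℤ.- 1ℤ
  sum-χ²-translate i = begin
    sum (λ k → χ (k - i) ℤ.* χ (k - i))                         ≡⟨ sum-cong-≗ (λ k → χ² (k - i)) ⟩
    sum (λ k → 1ℤ ℤ.- 𝟙 (does (0# ≟ k - i)))                    ≡⟨ sum-distrib-- (λ _ → 1ℤ) (λ k → 𝟙 (does (0# ≟ k - i))) ⟩
    sum {q} (λ _ → 1ℤ) ℤ.- sum (λ k → 𝟙 (does (0# ≟ k - i)))   ≡⟨ cong₂ ℤ._-_ (sum-ones q) (count-translate 0# i) ⟩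
    + q ℤ.- 1ℤ                                                   ∎
    where open ≡-Reasoning

  χ≡1⇒nonzero-square : ∀ {x} → χ x ≡ 1ℤ → IsNonzeroSquare x
  χ≡1⇒nonzero-square {x} χx≡1 with x ≟F 0#
  ... | yes _ = ⊥-elim (0≢1ℤ χx≡1)
    where 0≢1ℤ : 0ℤ ≢ 1ℤ
          0≢1ℤ ()
  ... | no x≢0 with isSquare? x
  ...   | yes square = x≢0 , square
  ...   | no _ = ⊥-elim (-1≢1ℤ χx≡1)
    where -1≢1ℤ : -1ℤ ≢ 1ℤ
          -1≢1ℤ ()

  nonzero-square⇒χ≡1 : ∀ {x} → IsNonzeroSquare x → χ x ≡ 1ℤ
  nonzero-square⇒χ≡1 {x} (x≢0 , square) with x ≟F 0#
  ... | yes x≡0 = ⊥-elim (x≢0 x≡0)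
  ... | no _ with isSquare? x
  ...   | yes _ = refl
  ...   | no ¬square = ⊥-elim (¬square square)

  inv-nonzero-square : ∀ {x} → IsNonzeroSquare x → IsNonzeroSquare (inv x)
  inv-nonzero-square {x} (x≢0 , y , y²≡x) = inv-nonzero x≢0 , inv y , *-cancelˡ x≢0 (begin
    x * (inv y * inv y)              ≡⟨ cong (_* (inv y * inv y)) y²≡x ⟨
    (y * y) * (inv y * inv y)        ≡⟨ solve 2 (λ y z → (y :* y) :* (z :* z) := (y :* z) :* (y :* z)) refl y (inv y) ⟩
    (y * inv y) * (y * inv y)        ≡⟨ cong (λ u → u * u) (*-inverseʳ y≢0) ⟩
    1# * 1#                          ≡⟨ *-identityˡ 1# ⟩
    1#                               ≡⟨ *-inverseʳ x≢0 ⟨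
    x * inv x                        ∎)
    where
    open ≡-Reasoning
    y≢0 : y ≢ 0#
    y≢0 refl = x≢0 (trans (sym y²≡x) (zeroˡ 0#))

  inv-1 : inv 1# ≡ 1#
  inv-1 = *-cancelˡ (0≢1 ∘ sym) (trans (*-inverseʳ (0≢1 ∘ sym)) (sym (*-identityʳ 1#)))

  module OddCharacteristic (1+1≢0 : 1# + 1# ≢ 0#) where

    x+x≢0 : ∀ {x} → x ≢ 0# → x + x ≢ 0#
    x+x≢0 {x} x≢0 x+x≡0 with x*y≡0⇒x≡0⊎y≡0 (1# + 1#) x (trans (solve 1 (λ x → (con 1ℤ :+ con 1ℤ) :* x := x :+ x) refl x) x+x≡0)
    ... | inj₁ 1+1≡0 = 1+1≢0 1+1≡0
    ... | inj₂ x≡0   = x≢0 x≡0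

    x≢0⇒x≢-x : ∀ {x} → x ≢ 0# → x ≢ - x
    x≢0⇒x≢-x {x} x≢0 x≡-x = x+x≢0 x≢0 (trans (cong (_+_ x) x≡-x) (-‿inverseʳ x))

    roots≡1+χ : ∀ x → roots x ≡ 1ℤ ℤ.+ χ x
    roots≡1+χ x with x ≟F 0#
    ... | yes refl = trans (sum-point _ 0# (λ y y≢0 → cong 𝟙 (dec-false (y * y ≟ 0#) (x²≢0 y≢0))))
                           (cong 𝟙 (dec-true (0# * 0# ≟ 0#) (zeroˡ 0#)))
    ... | no x≢0 with isSquare? x
    ...   | no ¬square = sum-zero _ (λ y → cong 𝟙 (dec-false (y * y ≟ x) (λ y²≡x → ¬square (y , y²≡x))))
    ...   | yes (y₀ , y₀²≡x) = begin
      sum (λ y → 𝟙 (does (y * y ≟ x)))                              ≡⟨ sum-cong-≗ two-roots ⟩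
      sum (λ y → 𝟙 (does (y ≟ y₀)) ℤ.+ 𝟙 (does (y ≟ - y₀)))         ≡⟨ ∑-distrib-+ (λ y → 𝟙 (does (y ≟ y₀))) _ ⟩
      sum (λ y → 𝟙 (does (y ≟ y₀))) ℤ.+ sum (λ y → 𝟙 (does (y ≟ - y₀))) ≡⟨ cong₂ ℤ._+_ (count-≡ y₀) (count-≡ (- y₀)) ⟩
      + 2                                                                ∎
      where
      open ≡-Reasoning
      y₀≢0 : y₀ ≢ 0#
      y₀≢0 refl = x≢0 (trans (sym y₀²≡x) (zeroˡ 0#))
      two-roots : ∀ y → 𝟙 (does (y * y ≟ x)) ≡ 𝟙 (does (y ≟ y₀)) ℤ.+ 𝟙 (does (y ≟ - y₀))
      two-roots y with y ≟ y₀ | y ≟ - y₀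
      ... | yes refl | yes y₀≡-y₀ = ⊥-elim (x≢0⇒x≢-x y₀≢0 y₀≡-y₀)
      ... | yes refl | no _  = cong 𝟙 (dec-true (y * y ≟ x) y₀²≡x)
      ... | no _  | yes refl = cong 𝟙 (dec-true (y * y ≟ x)
                                 (trans (solve 1 (λ y → (:- y) :* (:- y) := y :* y) refl y₀) y₀²≡x))
      ... | no y≢y₀ | no y≢-y₀ = cong 𝟙 (dec-false (y * y ≟ x) λ y²≡x →
            [ y≢y₀ , y≢-y₀ ] (x²≡y²⇒x≡±y (trans y²≡x (sym y₀²≡x))))

    count-square-shift : ∀ {c} → c ≢ 0# → ∀ u →
      sum (λ y → 𝟙 (does ((y + u) * (y + u) ≟ y * y + c))) ≡ 1ℤ ℤ.- 𝟙 (does (u ≟ 0#))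
    count-square-shift {c} c≢0 u with u ≟ 0#
    ... | yes refl = sum-zero _ (λ y → cong 𝟙 (dec-false ((y + 0#) * (y + 0#) ≟ y * y + c) λ eq →
          c≢0 (trans (sym (square-difference y 0# c eq)) (solve 1 (λ y → (con 0ℤ :+ con 0ℤ) :* y :+ con 0ℤ :* con 0ℤ := con 0ℤ) refl y))))
    ... | no u≢0 = begin
      sum (λ y → 𝟙 (does ((y + u) * (y + u) ≟ y * y + c)))
        ≡⟨ sum-cong-≗ (λ y → 𝟙-cong ((y + u) * (y + u) ≟ y * y + c) ((u + u) * y + u * u ≟ c)
                                     (square-difference y u c) (square-difference⁻¹ y u c)) ⟩
      sum (λ y → 𝟙 (does ((u + u) * y + u * u ≟ c)))
        ≡⟨ count-affine (x+x≢0 u≢0) (u * u) c ⟩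
      1ℤ ∎
      where open ≡-Reasoning

    -- The sum counts the pairs (y, z) with z² − y² = i − j; putting z = y + u, the equation
    -- is linear in y with leading coefficient 2u, so each u ≠ 0 contributes one pair.
    sum-roots-product : ∀ {i j} → i ≢ j → sum (λ k → roots (k - i) ℤ.* roots (k - j)) ≡ + q ℤ.- 1ℤ
    sum-roots-product {i} {j} i≢j = begin
      sum (λ k → roots (k - i) ℤ.* roots (k - j))
        ≡⟨ sum-cong-≗ (λ k → sum-*-sum (λ y → root k i y) (λ z → root k j z)) ⟩
      sum (λ k → sum (λ y → sum (λ z → root k i y ℤ.* root k j z)))
        ≡⟨ ∑-comm (λ k y → sum (λ z → root k i y ℤ.* root k j z)) ⟩
      sum (λ y → sum (λ k → sum (λ z → root k i y ℤ.* root k j z)))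
        ≡⟨ sum-cong-≗ (λ y → ∑-comm (λ k z → root k i y ℤ.* root k j z)) ⟩
      sum (λ y → sum (λ z → sum (λ k → root k i y ℤ.* root k j z)))
        ≡⟨ sum-cong-≗ (λ y → sum-cong-≗ (λ z → common-k y z)) ⟩
      sum (λ y → sum (λ z → 𝟙 (does (z * z ≟ y * y + (i - j)))))
        ≡⟨ sum-cong-≗ (λ y → sym (sum-reindex (_+_ y) (λ z → z - y)
             (λ z → solve 2 (λ y z → y :+ (z :- y) := z) refl y z)
             (λ u → solve 2 (λ y u → (y :+ u) :- y := u) refl y u)
             (λ z → 𝟙 (does (z * z ≟ y * y + (i - j)))))) ⟩
      sum (λ y → sum (λ u → 𝟙 (does ((y + u) * (y + u) ≟ y * y + (i - j)))))
        ≡⟨ ∑-comm (λ y u → 𝟙 (does ((y + u) * (y + u) ≟ y * y + (i - j)))) ⟩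
      sum (λ u → sum (λ y → 𝟙 (does ((y + u) * (y + u) ≟ y * y + (i - j)))))
        ≡⟨ sum-cong-≗ (count-square-shift i-j≢0) ⟩
      sum (λ u → 1ℤ ℤ.- 𝟙 (does (u ≟ 0#)))
        ≡⟨ sum-distrib-- (λ _ → 1ℤ) (λ u → 𝟙 (does (u ≟ 0#))) ⟩
      sum {q} (λ _ → 1ℤ) ℤ.- sum (λ u → 𝟙 (does (u ≟ 0#)))
        ≡⟨ cong₂ ℤ._-_ (sum-ones q) (count-≡ 0#) ⟩
      + q ℤ.- 1ℤ ∎
      where
      open ≡-Reasoning
      root : Fin q → Fin q → Fin q → ℤ
      root k i y = 𝟙 (does (y * y ≟ k - i))
      i-j≢0 : i - j ≢ 0#
      i-j≢0 = i≢j ∘ x-y≡0⇒x≡y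
      common-k : ∀ y z → sum (λ k → root k i y ℤ.* root k j z) ≡ 𝟙 (does (z * z ≟ y * y + (i - j)))
      common-k y z = begin
        sum (λ k → root k i y ℤ.* root k j z)
          ≡⟨ sum-point _ (y * y + i) (λ k k≢y²+i → cong (ℤ._* root k j z) (cong 𝟙 (dec-false (y * y ≟ k - i)
               (λ y²≡k-i → k≢y²+i (trans (solve 2 (λ k i → k := (k :- i) :+ i) refl k i) (cong (_+ i) (sym y²≡k-i))))))) ⟩
        root (y * y + i) i y ℤ.* root (y * y + i) j z
          ≡⟨ cong (ℤ._* root (y * y + i) j z) (cong 𝟙 (dec-true (y * y ≟ (y * y + i) - i)
               (solve 2 (λ a i → a := (a :+ i) :- i) refl (y * y) i))) ⟩
        1ℤ ℤ.* root (y * y + i) j z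
          ≡⟨ ℤ.*-identityˡ _ ⟩
        𝟙 (does (z * z ≟ (y * y + i) - j))
          ≡⟨ cong (λ w → 𝟙 (does (z * z ≟ w))) (solve 3 (λ a i j → (a :+ i) :- j := a :+ (i :- j)) refl (y * y) i j) ⟩
        𝟙 (does (z * z ≟ y * y + (i - j))) ∎

    χ≡roots-1 : ∀ x → χ x ≡ roots x ℤ.- 1ℤ
    χ≡roots-1 x = trans (cancel (χ x)) (cong (ℤ._- 1ℤ) (sym (roots≡1+χ x)))
      where
      cancel : ∀ a → a ≡ (1ℤ ℤ.+ a) ℤ.- 1ℤ
      cancel = solve-∀

    sum-χ-translate : ∀ i → sum (λ k → χ (k - i)) ≡ 0ℤ
    sum-χ-translate i = begin
      sum (λ k → χ (k - i))                             ≡⟨ sum-cong-≗ (λ k → χ≡roots-1 (k - i)) ⟩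
      sum (λ k → roots (k - i) ℤ.- 1ℤ)                  ≡⟨ sum-distrib-- (λ k → roots (k - i)) (λ _ → 1ℤ) ⟩
      sum (λ k → roots (k - i)) ℤ.- sum {q} (λ _ → 1ℤ)  ≡⟨ cong₂ ℤ._-_ (sum-roots-translate i) (sum-ones q) ⟩
      + q ℤ.- + q                                       ≡⟨ ℤ.+-inverseʳ (+ q) ⟩
      0ℤ                                                ∎
      where open ≡-Reasoning

    sum-χχ-translate : ∀ {i j} → i ≢ j → sum (λ k → χ (k - i) ℤ.* χ (k - j)) ≡ -1ℤ
    sum-χχ-translate {i} {j} i≢j = begin
      sum (λ k → χ (k - i) ℤ.* χ (k - j))
        ≡⟨ sum-cong-≗ (λ k → trans (cong₂ ℤ._*_ (χ≡roots-1 (k - i)) (χ≡roots-1 (k - j))) (expand (r i k) (r j k))) ⟩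
      sum (λ k → (r i k ℤ.* r j k ℤ.- r i k) ℤ.- (r j k ℤ.- 1ℤ))
        ≡⟨ sum-distrib-- (λ k → r i k ℤ.* r j k ℤ.- r i k) (λ k → r j k ℤ.- 1ℤ) ⟩
      sum (λ k → r i k ℤ.* r j k ℤ.- r i k) ℤ.- sum (λ k → r j k ℤ.- 1ℤ)
        ≡⟨ cong₂ ℤ._-_ (sum-distrib-- (λ k → r i k ℤ.* r j k) (r i)) (sum-distrib-- (r j) (λ _ → 1ℤ)) ⟩
      (sum (λ k → r i k ℤ.* r j k) ℤ.- sum (r i)) ℤ.- (sum (r j) ℤ.- sum {q} (λ _ → 1ℤ))
        ≡⟨ cong₂ ℤ._-_ (cong₂ ℤ._-_ (sum-roots-product i≢j) (sum-roots-translate i))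
                        (cong₂ ℤ._-_ (sum-roots-translate j) (sum-ones q)) ⟩
      ((+ q ℤ.- 1ℤ) ℤ.- + q) ℤ.- (+ q ℤ.- + q)
        ≡⟨ simplify (+ q) ⟩
      -1ℤ ∎
      where
      open ≡-Reasoning
      r : Fin q → Fin q → ℤ
      r i k = roots (k - i)
      expand : ∀ a b → (a ℤ.- 1ℤ) ℤ.* (b ℤ.- 1ℤ) ≡ (a ℤ.* b ℤ.- a) ℤ.- (b ℤ.- 1ℤ)
      expand = solve-∀
      simplify : ∀ n → ((n ℤ.- 1ℤ) ℤ.- n) ℤ.- (n ℤ.- n) ≡ -1ℤ
      simplify = solve-∀

    count-nonzero-squares : + 2 ℤ.* sum (λ x → 𝟙 (does (χ x ℤ.≟ 1ℤ))) ≡ + q ℤ.- 1ℤ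
    count-nonzero-squares = begin
      + 2 ℤ.* sum (λ x → 𝟙 (does (χ x ℤ.≟ 1ℤ)))          ≡⟨ *-distribˡ-sum (+ 2) (λ x → 𝟙 (does (χ x ℤ.≟ 1ℤ))) ⟩
      sum (λ x → + 2 ℤ.* 𝟙 (does (χ x ℤ.≟ 1ℤ)))          ≡⟨ sum-cong-≗ twice-indicator ⟩
      sum (λ x → χ x ℤ.* χ x ℤ.+ χ x)                    ≡⟨ ∑-distrib-+ (λ x → χ x ℤ.* χ x) χ ⟩
      sum (λ x → χ x ℤ.* χ x) ℤ.+ sum χ
        ≡⟨ cong₂ ℤ._+_ (trans (sum-cong-≗ (λ x → cong (λ u → χ u ℤ.* χ u) (x-0≡x x))) (sum-χ²-translate 0#))
                       (trans (sum-cong-≗ (cong χ ∘ x-0≡x)) (sum-χ-translate 0#)) ⟩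
      (+ q ℤ.- 1ℤ) ℤ.+ 0ℤ                                ≡⟨ ℤ.+-identityʳ _ ⟩
      + q ℤ.- 1ℤ                                         ∎
      where
      open ≡-Reasoning
      x-0≡x : ∀ x → x ≡ x - 0#
      x-0≡x = solve 1 (λ x → x := x :- con 0ℤ) refl
      twice-indicator : ∀ x → + 2 ℤ.* 𝟙 (does (χ x ℤ.≟ 1ℤ)) ≡ χ x ℤ.* χ x ℤ.+ χ x
      twice-indicator x with x ≟F 0#
      ... | yes _ = refl
      ... | no _ with isSquare? x
      ...   | yes _ = refl
      ...   | no _  = refl

    -- Inversion permutes the (q − 1)/2 = 2t nonzero squares and fixes only ±1 among them;
    -- were −1 a non-square, 1 would be the only fixed point and 2t would be odd.
    -1-isSquare : ∀ t → q ≡ suc ((t ℕ.+ t) ℕ.+ (t ℕ.+ t)) → ∃[ y ] y * y ≡ - 1#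
    -1-isSquare t q≡1+4t with isSquare? (- 1#)
    ... | yes square = square
    ... | no ¬square =
      let e , squares≡fixed+2e = count-by-involution inv inv-involutive {P = λ x → χ x ≡ 1ℤ} (λ x → χ x ℤ.≟ 1ℤ) closed
      in ⊥-elim (odd≢even e (+ t) (begin
        1ℤ ℤ.+ (e ℤ.+ e)
          ≡⟨ cong (ℤ._+ (e ℤ.+ e)) fixed-points ⟨
        sum (λ x → 𝟙 (does (χ x ℤ.≟ 1ℤ) ∧ does (x ≟ inv x))) ℤ.+ (e ℤ.+ e)
          ≡⟨ squares≡fixed+2e ⟨
        sum (λ x → 𝟙 (does (χ x ℤ.≟ 1ℤ)))
          ≡⟨ ℤ.*-cancelˡ-≡ (+ 2) _ _ twice-count ⟩
        + t ℤ.+ + t ∎))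
      where
      open ≡-Reasoning
      closed : ∀ x → χ (inv x) ≡ 1ℤ → χ x ≡ 1ℤ
      closed x χ-inv-x≡1 = nonzero-square⇒χ≡1
        (subst IsNonzeroSquare (inv-involutive x) (inv-nonzero-square {inv x} (χ≡1⇒nonzero-square χ-inv-x≡1)))
      x≡inv-x⇒x≡1 : ∀ {x} → χ x ≡ 1ℤ → x ≡ inv x → x ≡ 1#
      x≡inv-x⇒x≡1 {x} χx≡1 x≡inv-x with χ≡1⇒nonzero-square χx≡1
      ... | x≢0 , root-of-x with x²≡y²⇒x≡±y (trans (cong (x *_) x≡inv-x) (trans (*-inverseʳ x≢0) (sym (*-identityˡ 1#))))
      ...   | inj₁ x≡1  = x≡1
      ...   | inj₂ x≡-1 = ⊥-elim (¬square (subst (λ u → ∃[ y ] y * y ≡ u) x≡-1 root-of-x))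
      fixed-points : sum (λ x → 𝟙 (does (χ x ℤ.≟ 1ℤ) ∧ does (x ≟ inv x))) ≡ 1ℤ
      fixed-points = trans (sum-point _ 1# not-fixed) (cong 𝟙 (cong₂ _∧_
        (dec-true (χ 1# ℤ.≟ 1ℤ) (nonzero-square⇒χ≡1 ((0≢1 ∘ sym) , 1# , *-identityˡ 1#)))
        (dec-true (1# ≟ inv 1#) (sym inv-1))))
        where
        not-fixed : ∀ x → x ≢ 1# → 𝟙 (does (χ x ℤ.≟ 1ℤ) ∧ does (x ≟ inv x)) ≡ 0ℤ
        not-fixed x x≢1 with χ x ℤ.≟ 1ℤ | x ≟ inv x
        ... | no _      | _            = refl
        ... | yes _     | no _         = refl
        ... | yes χx≡1  | yes x≡inv-x  = ⊥-elim (x≢1 (x≡inv-x⇒x≡1 χx≡1 x≡inv-x))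
      four : ∀ a → (a ℤ.+ a) ℤ.+ (a ℤ.+ a) ≡ + 2 ℤ.* (a ℤ.+ a)
      four = solve-∀
      twice-count : + 2 ℤ.* sum (λ x → 𝟙 (does (χ x ℤ.≟ 1ℤ))) ≡ + 2 ℤ.* (+ t ℤ.+ + t)
      twice-count = trans count-nonzero-squares (trans (cong (λ n → + n ℤ.- 1ℤ) q≡1+4t) (four (+ t)))

module HadamardMatrices where

  open FiniteSums
  open import Data.Bool using (Bool; true; false; _∧_)
  open import Data.Empty using (⊥-elim)
  open import Data.Fin as Fin using (Fin; zero; suc)
  open import Data.Fin.Properties using (suc-injective)
  open import Data.Fin.Subset using (Subset; _∩_; ∣_∣)
  open import Data.Integer as ℤ using (ℤ; +_; 0ℤ; 1ℤ; -1ℤ)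
  import Data.Integer.Properties as ℤ
  open import Data.Integer.Tactic.RingSolver using (solve-∀)
  open import Data.Nat as ℕ using (ℕ; suc; _∸_)
  import Data.Nat.Properties as ℕ
  open import Data.Product using (Σ; _,_)
  open import Data.Sum using (_⊎_; inj₁; inj₂)
  open import Data.Vec using (tabulate; lookup)
  open import Data.Vec.Properties using (lookup-zipWith; lookup∘tabulate)
  open import Function using (_∘_)
  open import Relation.Binary.PropositionalEquality
    using (_≡_; refl; sym; trans; cong; cong₂; module ≡-Reasoning)
  open import Relation.Nullary using (does; yes; no)

  IsSign : ℤ → Set
  IsSign x = x ≡ 1ℤ ⊎ x ≡ -1ℤ

  sign-* : ∀ {x y} → IsSign x → IsSign y → IsSign (x ℤ.* y)
  sign-* (inj₁ refl) (inj₁ refl) = inj₁ refl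
  sign-* (inj₁ refl) (inj₂ refl) = inj₂ refl
  sign-* (inj₂ refl) (inj₁ refl) = inj₂ refl
  sign-* (inj₂ refl) (inj₂ refl) = inj₁ refl

  sign-square : ∀ {x} → IsSign x → x ℤ.* x ≡ 1ℤ
  sign-square (inj₁ refl) = refl
  sign-square (inj₂ refl) = refl

  RowOrthogonal : (n : ℕ) → (Fin n → Fin n → ℤ) → Set
  RowOrthogonal n H = ∀ i j → sum (λ k → H i k ℤ.* H j k) ≡ + n ℤ.* 𝟙 (does (i Fin.≟ j))

  isHadamard : ∀ {n} {H : Fin n → Fin n → ℤ} → (∀ i j → IsSign (H i j)) → RowOrthogonal n H → IsHadamard n H
  isHadamard {n} {H} signs orthogonal = signs , λ i j → trans (sumℤ≡sum (λ k → H i k ℤ.* H j k)) (trans (orthogonal i j) (kron-𝟙 i j))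
    where
    kron-𝟙 : ∀ i j → + n ℤ.* 𝟙 (does (i Fin.≟ j)) ≡ kron n i j
    kron-𝟙 i j with i Fin.≟ j
    ... | yes _ = ℤ.*-identityʳ (+ n)
    ... | no _  = ℤ.*-zeroʳ (+ n)

  border : ∀ {v} → (Fin v → Fin v → ℤ) → Fin (suc v) → Fin (suc v) → ℤ
  border N zero    _       = 1ℤ
  border N (suc p) zero    = 1ℤ
  border N (suc p) (suc b) = N p b

  module _ {v} (N : Fin v → Fin v → ℤ) where

    border-sign : (∀ p b → IsSign (N p b)) → ∀ r c → IsSign (border N r c)
    border-sign signs zero    _       = inj₁ refl
    border-sign signs (suc p) zero    = inj₁ refl
    border-sign signs (suc p) (suc b) = signs p b

    border-orthogonal : (∀ p → sum (N p) ≡ -1ℤ) →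
      (∀ p p' → sum (λ b → N p b ℤ.* N p' b) ≡ + suc v ℤ.* 𝟙 (does (p Fin.≟ p')) ℤ.- 1ℤ) →
      RowOrthogonal (suc v) (border N)
    border-orthogonal row-sum gram zero zero = begin
      1ℤ ℤ.+ sum {v} (λ _ → 1ℤ)     ≡⟨ cong (ℤ._+_ 1ℤ) (sum-ones v) ⟩
      + suc v                       ≡⟨ ℤ.*-identityʳ (+ suc v) ⟨
      + suc v ℤ.* 1ℤ                ∎
      where open ≡-Reasoning
    border-orthogonal row-sum gram zero (suc p') = begin
      1ℤ ℤ.+ sum (λ b → 1ℤ ℤ.* N p' b)   ≡⟨ cong (ℤ._+_ 1ℤ) (trans (sum-cong-≗ (λ b → ℤ.*-identityˡ (N p' b))) (row-sum p')) ⟩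
      1ℤ ℤ.+ -1ℤ                         ≡⟨ ℤ.*-zeroʳ (+ suc v) ⟨
      + suc v ℤ.* 0ℤ                     ∎
      where open ≡-Reasoning
    border-orthogonal row-sum gram (suc p) zero = begin
      1ℤ ℤ.+ sum (λ b → N p b ℤ.* 1ℤ)    ≡⟨ cong (ℤ._+_ 1ℤ) (trans (sum-cong-≗ (λ b → ℤ.*-identityʳ (N p b))) (row-sum p)) ⟩
      1ℤ ℤ.+ -1ℤ                         ≡⟨ ℤ.*-zeroʳ (+ suc v) ⟨
      + suc v ℤ.* 0ℤ                     ∎
      where open ≡-Reasoning
    border-orthogonal row-sum gram (suc p) (suc p') = begin
      1ℤ ℤ.+ sum (λ b → N p b ℤ.* N p' b)                         ≡⟨ cong (ℤ._+_ 1ℤ) (gram p p') ⟩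
      1ℤ ℤ.+ (+ suc v ℤ.* 𝟙 (does (p Fin.≟ p')) ℤ.- 1ℤ)           ≡⟨ cancel (+ suc v ℤ.* 𝟙 (does (p Fin.≟ p'))) ⟩
      + suc v ℤ.* 𝟙 (does (p Fin.≟ p'))
        ≡⟨ cong (ℤ._*_ (+ suc v)) (𝟙-cong (p Fin.≟ p') (suc p Fin.≟ suc p') (cong suc) suc-injective) ⟩
      + suc v ℤ.* 𝟙 (does (suc p Fin.≟ suc p'))                   ∎
      where
      open ≡-Reasoning
      cancel : ∀ x → 1ℤ ℤ.+ (x ℤ.- 1ℤ) ≡ x
      cancel = solve-∀

  module _ {n} (ε φ : Fin n → ℤ) (ε-sign : ∀ r → IsSign (ε r)) (φ-sign : ∀ c → IsSign (φ c)) where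

    rescale : (Fin n → Fin n → ℤ) → Fin n → Fin n → ℤ
    rescale H r c = ε r ℤ.* (H r c ℤ.* φ c)

    rescale-sign : ∀ {H} → (∀ r c → IsSign (H r c)) → ∀ r c → IsSign (rescale H r c)
    rescale-sign signs r c = sign-* (ε-sign r) (sign-* (signs r c) (φ-sign c))

    rescale-orthogonal : ∀ {H} → RowOrthogonal n H → RowOrthogonal n (rescale H)
    rescale-orthogonal {H} orthogonal r r' = begin
      sum (λ c → rescale H r c ℤ.* rescale H r' c)
        ≡⟨ sum-cong-≗ (λ c → trans (regroup (ε r) (ε r') (H r c) (H r' c) (φ c))
                                   (cong (λ s → (ε r ℤ.* ε r') ℤ.* ((H r c ℤ.* H r' c) ℤ.* s)) (sign-square (φ-sign c)))) ⟩
      sum (λ c → (ε r ℤ.* ε r') ℤ.* ((H r c ℤ.* H r' c) ℤ.* 1ℤ))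
        ≡⟨ sum-cong-≗ (λ c → cong (ℤ._*_ (ε r ℤ.* ε r')) (ℤ.*-identityʳ (H r c ℤ.* H r' c))) ⟩
      sum (λ c → (ε r ℤ.* ε r') ℤ.* (H r c ℤ.* H r' c))
        ≡⟨ *-distribˡ-sum (ε r ℤ.* ε r') (λ c → H r c ℤ.* H r' c) ⟨
      (ε r ℤ.* ε r') ℤ.* sum (λ c → H r c ℤ.* H r' c)
        ≡⟨ cong (ℤ._*_ (ε r ℤ.* ε r')) (orthogonal r r') ⟩
      (ε r ℤ.* ε r') ℤ.* (+ n ℤ.* 𝟙 (does (r Fin.≟ r')))
        ≡⟨ signs-cancel (r Fin.≟ r') ⟩
      + n ℤ.* 𝟙 (does (r Fin.≟ r'))     ∎
      where
      open ≡-Reasoning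
      regroup : ∀ a b x y f → (a ℤ.* (x ℤ.* f)) ℤ.* (b ℤ.* (y ℤ.* f)) ≡ (a ℤ.* b) ℤ.* ((x ℤ.* y) ℤ.* (f ℤ.* f))
      regroup = solve-∀
      signs-cancel : ∀ d → (ε r ℤ.* ε r') ℤ.* (+ n ℤ.* 𝟙 (does d)) ≡ + n ℤ.* 𝟙 (does d)
      signs-cancel (yes refl) = trans (cong (ℤ._* (+ n ℤ.* 1ℤ)) (sign-square (ε-sign r))) (ℤ.*-identityˡ _)
      signs-cancel (no _)     = trans (cong (ℤ._*_ (ε r ℤ.* ε r')) (ℤ.*-zeroʳ (+ n)))
                                      (trans (ℤ.*-zeroʳ (ε r ℤ.* ε r')) (sym (ℤ.*-zeroʳ (+ n))))

    rescale-row-sum : ∀ H r → sum (rescale H r) ≡ ε r ℤ.* sum (λ c → H r c ℤ.* φ c)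
    rescale-row-sum H r = sym (*-distribˡ-sum (ε r) (λ c → H r c ℤ.* φ c))

  positive-support : ∀ {v} → (Fin v → ℤ) → Subset v
  positive-support a = tabulate (λ p → does (a p ℤ.≟ 1ℤ))

  sum-sign-weighted : ∀ {v} (a : Fin v → ℤ) → (∀ b → IsSign (a b)) → (D : Subset v) →
    sum (λ b → a b ℤ.* 𝟙 (lookup D b)) ≡ + 2 ℤ.* + ∣ positive-support a ∩ D ∣ ℤ.- + ∣ D ∣
  sum-sign-weighted a signs D = begin
    sum (λ b → a b ℤ.* 𝟙 (lookup D b))
      ≡⟨ sum-cong-≗ (λ b → trans (cong (ℤ._* 𝟙 (lookup D b)) (sign≡2χ-1 (signs b))) (expand (𝟙 (positive b)) (𝟙 (lookup D b)))) ⟩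
    sum (λ b → + 2 ℤ.* (𝟙 (positive b) ℤ.* 𝟙 (lookup D b)) ℤ.- 𝟙 (lookup D b))
      ≡⟨ sum-distrib-- (λ b → + 2 ℤ.* (𝟙 (positive b) ℤ.* 𝟙 (lookup D b))) (𝟙 ∘ lookup D) ⟩
    sum (λ b → + 2 ℤ.* (𝟙 (positive b) ℤ.* 𝟙 (lookup D b))) ℤ.- sum (𝟙 ∘ lookup D)
      ≡⟨ cong₂ ℤ._-_ (trans (sym (*-distribˡ-sum (+ 2) (λ b → 𝟙 (positive b) ℤ.* 𝟙 (lookup D b))))
                            (cong (ℤ._*_ (+ 2)) (sym (trans (card≡sum (positive-support a ∩ D)) (sum-cong-≗ lookup-∩)))))
                     (sym (card≡sum D)) ⟩
    + 2 ℤ.* + ∣ positive-support a ∩ D ∣ ℤ.- + ∣ D ∣   ∎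
    where
    open ≡-Reasoning
    positive : _ → Bool
    positive b = does (a b ℤ.≟ 1ℤ)
    sign≡2χ-1 : ∀ {b} → IsSign (a b) → a b ≡ + 2 ℤ.* 𝟙 (does (a b ℤ.≟ 1ℤ)) ℤ.- 1ℤ
    sign≡2χ-1 {b} (inj₁ ab≡1)  rewrite ab≡1  = refl
    sign≡2χ-1 {b} (inj₂ ab≡-1) rewrite ab≡-1 = refl
    expand : ∀ x d → (+ 2 ℤ.* x ℤ.- 1ℤ) ℤ.* d ≡ + 2 ℤ.* (x ℤ.* d) ℤ.- d
    expand = solve-∀
    lookup-∩ : ∀ b → 𝟙 (lookup (positive-support a ∩ D) b) ≡ 𝟙 (positive b) ℤ.* 𝟙 (lookup D b)
    lookup-∩ b = trans (cong 𝟙 (trans (lookup-zipWith _∧_ b (positive-support a) D)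
                                      (cong (_∧ lookup D b) (lookup∘tabulate positive b))))
                       (𝟙-∧ (positive b) (lookup D b))

  module _ {v} (N : Fin v → Fin v → ℤ) (D : Subset v) where

    column-signs : Fin (suc v) → ℤ
    column-signs zero    = 1ℤ
    column-signs (suc b) = 1ℤ ℤ.- + 2 ℤ.* 𝟙 (lookup D b)

    column-signs-sign : ∀ c → IsSign (column-signs c)
    column-signs-sign zero = inj₁ refl
    column-signs-sign (suc b) with lookup D b
    ... | true  = inj₂ refl
    ... | false = inj₁ refl

    private
      weighted : ∀ x d → x ℤ.* (1ℤ ℤ.- + 2 ℤ.* d) ≡ 1ℤ ℤ.* x ℤ.+ ℤ.- + 2 ℤ.* (x ℤ.* d)
      weighted = solve-∀

    border-weighted-row-sum-apex : sum (λ c → border N zero c ℤ.* column-signs c) ≡ + suc v ℤ.- + 2 ℤ.* + ∣ D ∣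
    border-weighted-row-sum-apex = begin
      1ℤ ℤ.+ sum (λ b → 1ℤ ℤ.* column-signs (suc b))
        ≡⟨ cong (ℤ._+_ 1ℤ) (trans (sum-cong-≗ (λ b → weighted 1ℤ (𝟙 (lookup D b))))
                                  (sum-linear 1ℤ (ℤ.- + 2) (λ _ → 1ℤ) (λ b → 1ℤ ℤ.* 𝟙 (lookup D b)))) ⟩
      1ℤ ℤ.+ (1ℤ ℤ.* sum {v} (λ _ → 1ℤ) ℤ.+ ℤ.- + 2 ℤ.* sum (λ b → 1ℤ ℤ.* 𝟙 (lookup D b)))
        ≡⟨ cong₂ (λ s d → 1ℤ ℤ.+ (1ℤ ℤ.* s ℤ.+ ℤ.- + 2 ℤ.* d)) (sum-ones v)
                 (trans (sum-cong-≗ (λ b → ℤ.*-identityˡ (𝟙 (lookup D b)))) (sym (card≡sum D))) ⟩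
      1ℤ ℤ.+ (1ℤ ℤ.* + v ℤ.+ ℤ.- + 2 ℤ.* + ∣ D ∣)
        ≡⟨ simplify (+ v) (+ ∣ D ∣) ⟩
      + suc v ℤ.- + 2 ℤ.* + ∣ D ∣   ∎
      where
      open ≡-Reasoning
      simplify : ∀ v d → 1ℤ ℤ.+ (1ℤ ℤ.* v ℤ.+ ℤ.- + 2 ℤ.* d) ≡ (1ℤ ℤ.+ v) ℤ.- + 2 ℤ.* d
      simplify = solve-∀

    border-weighted-row-sum : (∀ p b → IsSign (N p b)) → (∀ p b → N p b ≡ N b p) → (∀ p → sum (N p) ≡ -1ℤ) →
      ∀ p → sum (λ c → border N (suc p) c ℤ.* column-signs c)
              ≡ + 2 ℤ.* + ∣ D ∣ ℤ.- + 4 ℤ.* + ∣ positive-support (λ b → N b p) ∩ D ∣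
    border-weighted-row-sum signs symmetric row-sum p = begin
      1ℤ ℤ.+ sum (λ b → N p b ℤ.* column-signs (suc b))
        ≡⟨ cong (ℤ._+_ 1ℤ) (trans (sum-cong-≗ (λ b → weighted (N p b) (𝟙 (lookup D b))))
                                  (sum-linear 1ℤ (ℤ.- + 2) (N p) (λ b → N p b ℤ.* 𝟙 (lookup D b)))) ⟩
      1ℤ ℤ.+ (1ℤ ℤ.* sum (N p) ℤ.+ ℤ.- + 2 ℤ.* sum (λ b → N p b ℤ.* 𝟙 (lookup D b)))
        ≡⟨ cong₂ (λ s d → 1ℤ ℤ.+ (1ℤ ℤ.* s ℤ.+ ℤ.- + 2 ℤ.* d)) (row-sum p)
                 (trans (sum-cong-≗ (λ b → cong (ℤ._* 𝟙 (lookup D b)) (symmetric p b)))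
                        (sum-sign-weighted (λ b → N b p) (λ b → signs b p) D)) ⟩
      1ℤ ℤ.+ (1ℤ ℤ.* -1ℤ ℤ.+ ℤ.- + 2 ℤ.* (+ 2 ℤ.* + ∣ positive-support (λ b → N b p) ∩ D ∣ ℤ.- + ∣ D ∣))
        ≡⟨ simplify (+ ∣ positive-support (λ b → N b p) ∩ D ∣) (+ ∣ D ∣) ⟩
      + 2 ℤ.* + ∣ D ∣ ℤ.- + 4 ℤ.* + ∣ positive-support (λ b → N b p) ∩ D ∣   ∎
      where
      open ≡-Reasoning
      simplify : ∀ x d → 1ℤ ℤ.+ (1ℤ ℤ.* -1ℤ ℤ.+ ℤ.- + 2 ℤ.* (+ 2 ℤ.* x ℤ.- d)) ≡ + 2 ℤ.* d ℤ.- + 4 ℤ.* x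
      simplify = solve-∀

  module _ {v} (N : Fin v → Fin v → ℤ)
           (signs : ∀ p b → IsSign (N p b)) (symmetric : ∀ p b → N p b ≡ N b p)
           (row-sum : ∀ p → sum (N p) ≡ -1ℤ)
           (gram : ∀ p p' → sum (λ b → N p b ℤ.* N p' b) ≡ + suc v ℤ.* 𝟙 (does (p Fin.≟ p')) ℤ.- 1ℤ)
           (m : ℕ) .{{_ : ℕ.NonZero m}} (D : Subset v) where

    private
      x : Fin v → ℕ
      x p = ∣ positive-support (λ b → N b p) ∩ D ∣

      row-signs : Fin (suc v) → ℤ
      row-signs zero = 1ℤ
      row-signs (suc p) with x p ℕ.≟ m ℕ.* m
      ... | yes _ = -1ℤ
      ... | no _  = 1ℤ

      row-signs-sign : ∀ r → IsSign (row-signs r)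
      row-signs-sign zero = inj₁ refl
      row-signs-sign (suc p) with x p ℕ.≟ m ℕ.* m
      ... | yes _ = inj₂ refl
      ... | no _  = inj₁ refl

      H : Fin (suc v) → Fin (suc v) → ℤ
      H = rescale row-signs (column-signs N D) row-signs-sign (column-signs-sign N D) (border N)

      isHadamard-H : IsHadamard (suc v) H
      isHadamard-H = isHadamard
        (rescale-sign _ _ row-signs-sign (column-signs-sign N D) {border N} (border-sign N signs))
        (rescale-orthogonal _ _ row-signs-sign (column-signs-sign N D) {border N} (border-orthogonal N row-sum gram))

      μ : ℤ
      μ = + m

      cast-∸ : ∀ {a b} → b ℕ.≤ a → + (a ∸ b) ≡ + a ℤ.- + b
      cast-∸ {a} {b} b≤a = trans (sym (ℤ.⊖-≥ b≤a)) (sym (ℤ.m-n≡m⊖n a b))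

      cast-m² : + (m ℕ.* m) ≡ μ ℤ.* μ
      cast-m² = ℤ.pos-* m m

      cast-cm² : ∀ c → + (c ℕ.* m ℕ.* m) ≡ + c ℤ.* (μ ℤ.* μ)
      cast-cm² c = trans (ℤ.pos-* (c ℕ.* m) m) (trans (cong (ℤ._* μ) (ℤ.pos-* c m)) (ℤ.*-assoc (+ c) μ μ))

      cast-m²-m : + (m ℕ.* m ∸ m) ≡ μ ℤ.* μ ℤ.- μ
      cast-m²-m = trans (cast-∸ (ℕ.m≤m*n m m)) (cong (ℤ._- μ) cast-m²)

      cast-2m²-m : + (2 ℕ.* m ℕ.* m ∸ m) ≡ + 2 ℤ.* (μ ℤ.* μ) ℤ.- μ
      cast-2m²-m = trans (cast-∸ (ℕ.m≤n*m m (2 ℕ.* m) {{ℕ.m*n≢0 2 m}})) (cong (ℤ._- μ) (cast-cm² 2))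

    module _ (order : suc v ≡ 4 ℕ.* m ℕ.* m) (∣D∣ : ∣ D ∣ ≡ 2 ℕ.* m ℕ.* m ∸ m)
             (intersections : ∀ p → x p ≡ m ℕ.* m ∸ m ⊎ x p ≡ m ℕ.* m) where

      private
        weighted-row-sum : ∀ r → row-signs r ℤ.* sum (λ c → border N r c ℤ.* column-signs N D c) ≡ + 2 ℤ.* μ
        weighted-row-sum zero = begin
          1ℤ ℤ.* sum (λ c → border N zero c ℤ.* column-signs N D c)
            ≡⟨ cong (ℤ._*_ 1ℤ) (border-weighted-row-sum-apex N D) ⟩
          1ℤ ℤ.* (+ suc v ℤ.- + 2 ℤ.* + ∣ D ∣)
            ≡⟨ cong₂ (λ n d → 1ℤ ℤ.* (n ℤ.- + 2 ℤ.* d)) (trans (cong +_ order) (cast-cm² 4)) (trans (cong +_ ∣D∣) cast-2m²-m) ⟩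
          1ℤ ℤ.* (+ 4 ℤ.* (μ ℤ.* μ) ℤ.- + 2 ℤ.* (+ 2 ℤ.* (μ ℤ.* μ) ℤ.- μ))
            ≡⟨ simplify μ ⟩
          + 2 ℤ.* μ ∎
          where
          open ≡-Reasoning
          simplify : ∀ μ → 1ℤ ℤ.* (+ 4 ℤ.* (μ ℤ.* μ) ℤ.- + 2 ℤ.* (+ 2 ℤ.* (μ ℤ.* μ) ℤ.- μ)) ≡ + 2 ℤ.* μ
          simplify = solve-∀
        weighted-row-sum (suc p) =
          trans (cong (ℤ._*_ (row-signs (suc p))) (border-weighted-row-sum N D signs symmetric row-sum p)) (signed p)
          where
          signed : ∀ p → row-signs (suc p) ℤ.* (+ 2 ℤ.* + ∣ D ∣ ℤ.- + 4 ℤ.* + x p) ≡ + 2 ℤ.* μ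
          signed p with x p ℕ.≟ m ℕ.* m
          ... | yes x≡m² =
            trans (cong₂ (λ d y → -1ℤ ℤ.* (+ 2 ℤ.* d ℤ.- + 4 ℤ.* y)) (trans (cong +_ ∣D∣) cast-2m²-m) (trans (cong +_ x≡m²) cast-m²))
                  (simplify μ)
            where
            simplify : ∀ μ → -1ℤ ℤ.* (+ 2 ℤ.* (+ 2 ℤ.* (μ ℤ.* μ) ℤ.- μ) ℤ.- + 4 ℤ.* (μ ℤ.* μ)) ≡ + 2 ℤ.* μ
            simplify = solve-∀
          ... | no x≢m² with intersections p
          ...   | inj₂ x≡m²   = ⊥-elim (x≢m² x≡m²)
          ...   | inj₁ x≡m²-m =
            trans (cong₂ (λ d y → 1ℤ ℤ.* (+ 2 ℤ.* d ℤ.- + 4 ℤ.* y)) (trans (cong +_ ∣D∣) cast-2m²-m) (trans (cong +_ x≡m²-m) cast-m²-m))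
                  (simplify μ)
            where
            simplify : ∀ μ → 1ℤ ℤ.* (+ 2 ℤ.* (+ 2 ℤ.* (μ ℤ.* μ) ℤ.- μ) ℤ.- + 4 ℤ.* (μ ℤ.* μ ℤ.- μ)) ≡ + 2 ℤ.* μ
            simplify = solve-∀

        row-sums : ∀ r → sumℤ (H r) ≡ + (2 ℕ.* m)
        row-sums r = begin
          sumℤ (H r)                                                        ≡⟨ sumℤ≡sum (H r) ⟩
          sum (H r)                                                         ≡⟨ rescale-row-sum _ _ row-signs-sign (column-signs-sign N D) (border N) r ⟩
          row-signs r ℤ.* sum (λ c → border N r c ℤ.* column-signs N D c)   ≡⟨ weighted-row-sum r ⟩
          + 2 ℤ.* μ                                                         ≡⟨ ℤ.pos-* 2 m ⟨
          + (2 ℕ.* m)                                                       ∎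
          where open ≡-Reasoning

      regular-from-two-intersection-set : Σ (Fin (suc v) → Fin (suc v) → ℤ) (IsRegularHadamard (suc v))
      regular-from-two-intersection-set = H , isHadamard-H , 2 ℕ.* m , ℕ.>-nonZero⁻¹ (2 ℕ.* m) {{ℕ.m*n≢0 2 m}} , row-sums

module PaleyMatrix {q} (F : FiniteField q) (t : ℕ) (q≡1+4t : q ≡ ℕ.suc ((t ℕ.+ t) ℕ.+ (t ℕ.+ t))) where

  open FiniteSums
  open HadamardMatrices using (IsSign)
  open import Data.Empty using (⊥-elim)
  open import Data.Fin as Fin using (Fin; zero; suc; splitAt; _↑ˡ_; _↑ʳ_)
  open import Data.Fin.Properties using (splitAt-↑ˡ; splitAt-↑ʳ; splitAt⁻¹-↑ˡ; splitAt⁻¹-↑ʳ; suc-injective; ↑ˡ-injective; ↑ʳ-injective)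
  open import Data.Integer as ℤ using (ℤ; +_; 0ℤ; 1ℤ; -1ℤ)
  import Data.Integer.Properties as ℤ
  open import Data.Integer.Tactic.RingSolver using (solve-∀)
  open import Data.Nat as ℕ using (ℕ; suc)
  open import Data.Product using (∃-syntax; _,_; proj₁; proj₂)
  open import Data.Sum using (_⊎_; inj₁; inj₂)
  open import Function using (_∘_)
  open import Relation.Binary.PropositionalEquality
    using (_≡_; _≢_; refl; sym; trans; cong; cong₂; subst; module ≡-Reasoning)
  open import Relation.Nullary using (does; yes; no)
  open import Relation.Nullary.Decidable using (dec-true; dec-false)

  open FiniteField F using (M; δ; _≟F_; isSquare?; M₁; M₂; M₃; N')
  open FiniteFieldProperties F
  open OddCharacteristic (odd-order⇒1+1≢0 (t ℕ.+ t) q≡1+4t)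
  open CommutativeRing ring using (_+_; _*_; -_; _-_; 0#; 1#; -‿inverseʳ)
  open import Algebra.Properties.Ring (CommutativeRing.ring ring) using (-‿involutive; -0#≈0#)
  open IntegerCoefficients ring using (solve; _:=_; con; _:+_; _:*_; _:-_; :-_)

  M≡χ : ∀ i j → M i j ≡ χ (j - i)
  M≡χ i j with (j - i) ≟F 0#
  ... | yes _ = refl
  ... | no _ with isSquare? (j - i)
  ...   | yes _ = refl
  ...   | no _  = refl

  private
    ι : Fin q
    ι = proj₁ (-1-isSquare t q≡1+4t)

  square-neg : ∀ {x} → ∃[ y ] y * y ≡ x → ∃[ y ] y * y ≡ - x
  square-neg {x} (y , y²≡x) = ι * y , (begin
    (ι * y) * (ι * y)     ≡⟨ solve 2 (λ a y → (a :* y) :* (a :* y) := (a :* a) :* (y :* y)) refl ι y ⟩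
    (ι * ι) * (y * y)     ≡⟨ cong₂ _*_ (proj₂ (-1-isSquare t q≡1+4t)) y²≡x ⟩
    - 1# * x              ≡⟨ solve 1 (λ x → (:- con 1ℤ) :* x := :- x) refl x ⟩
    - x                   ∎)
    where open ≡-Reasoning

  χ-neg : ∀ x → χ (- x) ≡ χ x
  χ-neg x with x ≟F 0# | (- x) ≟F 0#
  ... | yes _    | yes _     = refl
  ... | yes refl | no -0≢0   = ⊥-elim (-0≢0 -0#≈0#)
  ... | no x≢0   | yes -x≡0  = ⊥-elim (x≢0 (trans (sym (-‿involutive x)) (trans (cong -_ -x≡0) -0#≈0#)))
  ... | no _     | no _ with isSquare? x | isSquare? (- x)
  ...   | yes _      | yes _      = refl
  ...   | no _       | no _       = refl
  ...   | yes square | no ¬square = ⊥-elim (¬square (square-neg square))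
  ...   | no ¬square | yes square = ⊥-elim (¬square (subst (λ u → ∃[ y ] y * y ≡ u) (-‿involutive x) (square-neg square)))

  M-symmetric : ∀ i j → M i j ≡ M j i
  M-symmetric i j = begin
    M i j            ≡⟨ M≡χ i j ⟩
    χ (j - i)        ≡⟨ cong χ (solve 2 (λ i j → j :- i := :- (i :- j)) refl i j) ⟩
    χ (- (i - j))    ≡⟨ χ-neg (i - j) ⟩
    χ (i - j)        ≡⟨ M≡χ j i ⟨
    M j i            ∎
    where open ≡-Reasoning

  M-diagonal : ∀ i → M i i ≡ 0ℤ
  M-diagonal i = trans (M≡χ i i) (trans (cong χ (-‿inverseʳ i)) χ-0)

  M-off-diagonal : ∀ {i j} → i ≢ j → M i j ≡ 1ℤ ⊎ M i j ≡ -1ℤ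
  M-off-diagonal {i} {j} i≢j rewrite M≡χ i j = χ-nonzero (λ j-i≡0 → i≢j (sym (x-y≡0⇒x≡y j-i≡0)))

  M-row-sum : ∀ i → sum (M i) ≡ 0ℤ
  M-row-sum i = trans (sum-cong-≗ (M≡χ i)) (sum-χ-translate i)

  M-gram : ∀ i j → sum (λ k → M i k ℤ.* M j k) ≡ + q ℤ.* δ i j ℤ.- 1ℤ
  M-gram i j with i ≟F j
  ... | yes refl = trans (sum-cong-≗ (λ k → cong₂ ℤ._*_ (M≡χ i k) (M≡χ i k)))
                         (trans (sum-χ²-translate i) (cong (ℤ._- 1ℤ) (sym (ℤ.*-identityʳ (+ q)))))
  ... | no i≢j   = trans (sum-cong-≗ (λ k → cong₂ ℤ._*_ (M≡χ i k) (M≡χ j k)))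
                         (trans (sum-χχ-translate i≢j) (cong (ℤ._- 1ℤ) (sym (ℤ.*-zeroʳ (+ q)))))

  data Position : Fin (suc (q ℕ.+ q)) → Set where
    apex   : Position zero
    first  : ∀ i → Position (suc (i ↑ˡ q))
    second : ∀ i → Position (suc (q ↑ʳ i))

  position : ∀ p → Position p
  position zero = apex
  position (suc b) with splitAt q b in eq
  ... | inj₁ i = subst (Position ∘ suc) (splitAt⁻¹-↑ˡ eq) (first i)
  ... | inj₂ i = subst (Position ∘ suc) (splitAt⁻¹-↑ʳ eq) (second i)

  entry : ∀ {p b} → Position p → Position b → ℤ
  entry apex       apex       = -1ℤ
  entry apex       (first j)  = -1ℤ
  entry apex       (second j) = 1ℤ
  entry (first i)  apex       = -1ℤ
  entry (first i)  (first j)  = M₁ i j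
  entry (first i)  (second j) = M₂ i j
  entry (second i) apex       = 1ℤ
  entry (second i) (first j)  = M₂ i j
  entry (second i) (second j) = M₃ i j

  N'≡entry : ∀ {p b} (v : Position p) (w : Position b) → N' p b ≡ entry v w
  N'≡entry apex       apex       = refl
  N'≡entry apex       (first j)  rewrite splitAt-↑ˡ q j q = refl
  N'≡entry apex       (second j) rewrite splitAt-↑ʳ q q j = refl
  N'≡entry (first i)  apex       rewrite splitAt-↑ˡ q i q = refl
  N'≡entry (first i)  (first j)  rewrite splitAt-↑ˡ q i q | splitAt-↑ˡ q j q = refl
  N'≡entry (first i)  (second j) rewrite splitAt-↑ˡ q i q | splitAt-↑ʳ q q j = refl
  N'≡entry (second i) apex       rewrite splitAt-↑ʳ q q i = refl
  N'≡entry (second i) (first j)  rewrite splitAt-↑ʳ q q i | splitAt-↑ˡ q j q = refl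
  N'≡entry (second i) (second j) rewrite splitAt-↑ʳ q q i | splitAt-↑ʳ q q j = refl

  sum-positions : (f : Fin (suc (q ℕ.+ q)) → ℤ) →
    sum f ≡ f zero ℤ.+ (sum (λ j → f (suc (j ↑ˡ q))) ℤ.+ sum (λ j → f (suc (q ↑ʳ j))))
  sum-positions f = cong (ℤ._+_ (f zero)) (sum-split {q} (f ∘ suc))

  M₁-sign : ∀ i j → IsSign (M₁ i j)
  M₁-sign i j with i ≟F j
  ... | yes refl = inj₁ (cong (ℤ._+ 1ℤ) (M-diagonal i))
  ... | no i≢j with M-off-diagonal i≢j
  ...   | inj₁ Mij≡1  = inj₁ (cong (ℤ._+ 0ℤ) Mij≡1)
  ...   | inj₂ Mij≡-1 = inj₂ (cong (ℤ._+ 0ℤ) Mij≡-1)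

  M₂-sign : ∀ i j → IsSign (M₂ i j)
  M₂-sign i j with i ≟F j
  ... | yes refl = inj₂ (cong (ℤ._- 1ℤ) (M-diagonal i))
  ... | no i≢j with M-off-diagonal i≢j
  ...   | inj₁ Mij≡1  = inj₁ (cong (ℤ._- 0ℤ) Mij≡1)
  ...   | inj₂ Mij≡-1 = inj₂ (cong (ℤ._- 0ℤ) Mij≡-1)

  M₃-sign : ∀ i j → IsSign (M₃ i j)
  M₃-sign i j with M₁-sign i j
  ... | inj₁ M₁ij≡1  = inj₂ (cong ℤ.-_ M₁ij≡1)
  ... | inj₂ M₁ij≡-1 = inj₁ (cong ℤ.-_ M₁ij≡-1)

  entry-sign : ∀ {p b} (v : Position p) (w : Position b) → IsSign (entry v w)
  entry-sign apex       apex       = inj₂ refl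
  entry-sign apex       (first j)  = inj₂ refl
  entry-sign apex       (second j) = inj₁ refl
  entry-sign (first i)  apex       = inj₂ refl
  entry-sign (first i)  (first j)  = M₁-sign i j
  entry-sign (first i)  (second j) = M₂-sign i j
  entry-sign (second i) apex       = inj₁ refl
  entry-sign (second i) (first j)  = M₂-sign i j
  entry-sign (second i) (second j) = M₃-sign i j

  M₁-symmetric : ∀ i j → M₁ i j ≡ M₁ j i
  M₁-symmetric i j = cong₂ ℤ._+_ (M-symmetric i j) (δ-symmetric i j)

  M₂-symmetric : ∀ i j → M₂ i j ≡ M₂ j i
  M₂-symmetric i j = cong₂ ℤ._-_ (M-symmetric i j) (δ-symmetric i j)

  entry-symmetric : ∀ {p b} (v : Position p) (w : Position b) → entry v w ≡ entry w v
  entry-symmetric apex       apex       = refl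
  entry-symmetric apex       (first j)  = refl
  entry-symmetric apex       (second j) = refl
  entry-symmetric (first i)  apex       = refl
  entry-symmetric (first i)  (first j)  = M₁-symmetric i j
  entry-symmetric (first i)  (second j) = M₂-symmetric i j
  entry-symmetric (second i) apex       = refl
  entry-symmetric (second i) (first j)  = M₂-symmetric i j
  entry-symmetric (second i) (second j) = cong ℤ.-_ (M₁-symmetric i j)

  N'-sign : ∀ p b → IsSign (N' p b)
  N'-sign p b = subst IsSign (sym (N'≡entry (position p) (position b))) (entry-sign (position p) (position b))

  N'-symmetric : ∀ p b → N' p b ≡ N' b p
  N'-symmetric p b = begin
    N' p b                          ≡⟨ N'≡entry (position p) (position b) ⟩
    entry (position p) (position b) ≡⟨ entry-symmetric (position p) (position b) ⟩
    entry (position b) (position p) ≡⟨ N'≡entry (position b) (position p) ⟨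
    N' b p                          ∎
    where open ≡-Reasoning

  M₁-row-sum : ∀ i → sum (M₁ i) ≡ 1ℤ
  M₁-row-sum i = trans (∑-distrib-+ (M i) (δ i)) (cong₂ ℤ._+_ (M-row-sum i) (sum-δ i))

  M₂-row-sum : ∀ i → sum (M₂ i) ≡ -1ℤ
  M₂-row-sum i = trans (sum-distrib-- (M i) (δ i)) (cong₂ ℤ._-_ (M-row-sum i) (sum-δ i))

  M₃-row-sum : ∀ i → sum (M₃ i) ≡ -1ℤ
  M₃-row-sum i = trans (sum-neg (M₁ i)) (cong ℤ.-_ (M₁-row-sum i))

  block-row-sum : ∀ {p} → Position p → ℤ
  block-row-sum v = entry v apex ℤ.+ (sum (λ j → entry v (first j)) ℤ.+ sum (λ j → entry v (second j)))

  block-row-product : ∀ {p p'} → Position p → Position p' → ℤ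
  block-row-product v v' = entry v apex ℤ.* entry v' apex ℤ.+
    (sum (λ j → entry v (first j) ℤ.* entry v' (first j)) ℤ.+ sum (λ j → entry v (second j) ℤ.* entry v' (second j)))

  N'-row-sum-blocks : ∀ {p} (v : Position p) → sum (N' p) ≡ block-row-sum v
  N'-row-sum-blocks {p} v = trans (sum-positions (N' p))
    (cong₂ ℤ._+_ (N'≡entry v apex) (cong₂ ℤ._+_ (sum-cong-≗ (N'≡entry v ∘ first)) (sum-cong-≗ (N'≡entry v ∘ second))))

  N'-row-product-blocks : ∀ {p p'} (v : Position p) (v' : Position p') →
    sum (λ b → N' p b ℤ.* N' p' b) ≡ block-row-product v v'
  N'-row-product-blocks {p} {p'} v v' = trans (sum-positions (λ b → N' p b ℤ.* N' p' b))
    (cong₂ ℤ._+_ (column apex) (cong₂ ℤ._+_ (sum-cong-≗ (column ∘ first)) (sum-cong-≗ (column ∘ second))))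
    where
    column : ∀ {b} (w : Position b) → N' p b ℤ.* N' p' b ≡ entry v w ℤ.* entry v' w
    column w = cong₂ ℤ._*_ (N'≡entry v w) (N'≡entry v' w)

  block-row-sum≡-1 : ∀ {p} (v : Position p) → block-row-sum v ≡ -1ℤ
  block-row-sum≡-1 apex = cong (ℤ._+_ -1ℤ) (begin
    sum {q} (λ _ → -1ℤ) ℤ.+ sum {q} (λ _ → 1ℤ)   ≡⟨ cong₂ ℤ._+_ (sum-const q -1ℤ) (sum-const q 1ℤ) ⟩
    + q ℤ.* -1ℤ ℤ.+ + q ℤ.* 1ℤ                   ≡⟨ cancel (+ q) ⟩
    0ℤ                                           ∎)
    where
    open ≡-Reasoning
    cancel : ∀ n → n ℤ.* -1ℤ ℤ.+ n ℤ.* 1ℤ ≡ 0ℤ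
    cancel = solve-∀
  block-row-sum≡-1 (first i)  = cong (ℤ._+_ -1ℤ) (cong₂ ℤ._+_ (M₁-row-sum i) (M₂-row-sum i))
  block-row-sum≡-1 (second i) = cong (ℤ._+_ 1ℤ) (cong₂ ℤ._+_ (M₂-row-sum i) (M₃-row-sum i))

  N'-row-sum : ∀ p → sum (N' p) ≡ -1ℤ
  N'-row-sum p = trans (N'-row-sum-blocks (position p)) (block-row-sum≡-1 (position p))

  block-row-product-comm : ∀ {p p'} (v : Position p) (v' : Position p') →
    block-row-product v v' ≡ block-row-product v' v
  block-row-product-comm v v' = cong₂ ℤ._+_ (ℤ.*-comm (entry v apex) (entry v' apex))
    (cong₂ ℤ._+_ (sum-cong-≗ (λ j → ℤ.*-comm (entry v (first j)) (entry v' (first j))))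
                 (sum-cong-≗ (λ j → ℤ.*-comm (entry v (second j)) (entry v' (second j)))))

  block-gram-apex-apex : block-row-product apex apex ≡ + suc (q ℕ.+ q)
  block-gram-apex-apex = cong (ℤ._+_ 1ℤ) (cong₂ ℤ._+_ (sum-ones q) (sum-ones q))

  block-gram-apex-first : ∀ j → block-row-product apex (first j) ≡ -1ℤ
  block-gram-apex-first j = cong (ℤ._+_ 1ℤ) (cong₂ ℤ._+_
    (trans (sym (*-distribˡ-sum -1ℤ (M₁ j))) (cong (ℤ._*_ -1ℤ) (M₁-row-sum j)))
    (trans (sym (*-distribˡ-sum 1ℤ (M₂ j))) (cong (ℤ._*_ 1ℤ) (M₂-row-sum j))))

  block-gram-apex-second : ∀ j → block-row-product apex (second j) ≡ -1ℤ
  block-gram-apex-second j = cong (ℤ._+_ -1ℤ) (cong₂ ℤ._+_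
    (trans (sym (*-distribˡ-sum -1ℤ (M₂ j))) (cong (ℤ._*_ -1ℤ) (M₂-row-sum j)))
    (trans (sym (*-distribˡ-sum 1ℤ (M₃ j))) (cong (ℤ._*_ 1ℤ) (M₃-row-sum j))))

  private
    -- (M ± I)(M ± I)ᵀ + (M ∓ I)(M ∓ I)ᵀ = 2MMᵀ + 2I, and MMᵀ = qI − J
    diagonal-blocks : ∀ (A B : Fin q → Fin q → ℤ) i j →
      (∀ k → A i k ℤ.* A j k ℤ.+ B i k ℤ.* B j k ≡ + 2 ℤ.* (M i k ℤ.* M j k) ℤ.+ + 2 ℤ.* (δ i k ℤ.* δ j k)) →
      1ℤ ℤ.+ (sum (λ k → A i k ℤ.* A j k) ℤ.+ sum (λ k → B i k ℤ.* B j k)) ≡ + suc (suc (q ℕ.+ q)) ℤ.* δ i j ℤ.- 1ℤ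
    diagonal-blocks A B i j pointwise = begin
      1ℤ ℤ.+ (sum (λ k → A i k ℤ.* A j k) ℤ.+ sum (λ k → B i k ℤ.* B j k))
        ≡⟨ cong (ℤ._+_ 1ℤ) (∑-distrib-+ (λ k → A i k ℤ.* A j k) (λ k → B i k ℤ.* B j k)) ⟨
      1ℤ ℤ.+ sum (λ k → A i k ℤ.* A j k ℤ.+ B i k ℤ.* B j k)
        ≡⟨ cong (ℤ._+_ 1ℤ) (trans (sum-cong-≗ pointwise) (sum-linear (+ 2) (+ 2) (λ k → M i k ℤ.* M j k) (λ k → δ i k ℤ.* δ j k))) ⟩
      1ℤ ℤ.+ (+ 2 ℤ.* sum (λ k → M i k ℤ.* M j k) ℤ.+ + 2 ℤ.* sum (λ k → δ i k ℤ.* δ j k))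
        ≡⟨ cong (ℤ._+_ 1ℤ) (cong₂ (λ a b → + 2 ℤ.* a ℤ.+ + 2 ℤ.* b) (M-gram i j) (trans (sum-δ-* i (δ j)) (δ-symmetric j i))) ⟩
      1ℤ ℤ.+ (+ 2 ℤ.* (+ q ℤ.* δ i j ℤ.- 1ℤ) ℤ.+ + 2 ℤ.* δ i j)
        ≡⟨ simplify (+ q) (δ i j) ⟩
      + suc (suc (q ℕ.+ q)) ℤ.* δ i j ℤ.- 1ℤ ∎
      where
      open ≡-Reasoning
      simplify : ∀ n d → 1ℤ ℤ.+ (+ 2 ℤ.* (n ℤ.* d ℤ.- 1ℤ) ℤ.+ + 2 ℤ.* d) ≡ (1ℤ ℤ.+ (1ℤ ℤ.+ (n ℤ.+ n))) ℤ.* d ℤ.- 1ℤ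
      simplify = solve-∀

  block-gram-first-first : ∀ i j → block-row-product (first i) (first j) ≡ + suc (suc (q ℕ.+ q)) ℤ.* δ i j ℤ.- 1ℤ
  block-gram-first-first i j = diagonal-blocks M₁ M₂ i j (λ k → expand (M i k) (δ i k) (M j k) (δ j k))
    where
    expand : ∀ a b c d → (a ℤ.+ b) ℤ.* (c ℤ.+ d) ℤ.+ (a ℤ.- b) ℤ.* (c ℤ.- d) ≡ + 2 ℤ.* (a ℤ.* c) ℤ.+ + 2 ℤ.* (b ℤ.* d)
    expand = solve-∀

  block-gram-second-second : ∀ i j → block-row-product (second i) (second j) ≡ + suc (suc (q ℕ.+ q)) ℤ.* δ i j ℤ.- 1ℤ
  block-gram-second-second i j = diagonal-blocks M₂ M₃ i j (λ k → expand (M i k) (δ i k) (M j k) (δ j k))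
    where
    expand : ∀ a b c d → (a ℤ.- b) ℤ.* (c ℤ.- d) ℤ.+ ℤ.- (a ℤ.+ b) ℤ.* ℤ.- (c ℤ.+ d) ≡ + 2 ℤ.* (a ℤ.* c) ℤ.+ + 2 ℤ.* (b ℤ.* d)
    expand = solve-∀

  block-gram-first-second : ∀ i j → block-row-product (first i) (second j) ≡ -1ℤ
  block-gram-first-second i j = begin
    -1ℤ ℤ.+ (sum (λ k → M₁ i k ℤ.* M₂ j k) ℤ.+ sum (λ k → M₂ i k ℤ.* M₃ j k))
      ≡⟨ cong (ℤ._+_ -1ℤ) (∑-distrib-+ (λ k → M₁ i k ℤ.* M₂ j k) (λ k → M₂ i k ℤ.* M₃ j k)) ⟨
    -1ℤ ℤ.+ sum (λ k → M₁ i k ℤ.* M₂ j k ℤ.+ M₂ i k ℤ.* M₃ j k)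
      ≡⟨ cong (ℤ._+_ -1ℤ) (trans (sum-cong-≗ (λ k → expand (M i k) (δ i k) (M j k) (δ j k)))
                                  (sum-linear (+ 2) (ℤ.- + 2) (λ k → δ i k ℤ.* M j k) (λ k → M i k ℤ.* δ j k))) ⟩
    -1ℤ ℤ.+ (+ 2 ℤ.* sum (λ k → δ i k ℤ.* M j k) ℤ.+ ℤ.- + 2 ℤ.* sum (λ k → M i k ℤ.* δ j k))
      ≡⟨ cong (ℤ._+_ -1ℤ) (cong₂ (λ a b → + 2 ℤ.* a ℤ.+ ℤ.- + 2 ℤ.* b) (sum-δ-* i (M j)) (trans (sum-*-δ j (M i)) (M-symmetric i j))) ⟩
    -1ℤ ℤ.+ (+ 2 ℤ.* M j i ℤ.+ ℤ.- + 2 ℤ.* M j i)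
      ≡⟨ simplify (M j i) ⟩
    -1ℤ ∎
    where
    open ≡-Reasoning
    expand : ∀ a b c d → (a ℤ.+ b) ℤ.* (c ℤ.- d) ℤ.+ (a ℤ.- b) ℤ.* ℤ.- (c ℤ.+ d) ≡ + 2 ℤ.* (b ℤ.* c) ℤ.+ ℤ.- + 2 ℤ.* (a ℤ.* d)
    expand = solve-∀
    simplify : ∀ x → -1ℤ ℤ.+ (+ 2 ℤ.* x ℤ.+ ℤ.- + 2 ℤ.* x) ≡ -1ℤ
    simplify = solve-∀

  private
    first≢second : ∀ i j → suc (i ↑ˡ q) ≢ suc (q ↑ʳ j)
    first≢second i j eq with trans (sym (splitAt-↑ˡ q i q)) (trans (cong (splitAt q) (suc-injective eq)) (splitAt-↑ʳ q q j))
    ... | ()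

    off-diagonal : ∀ {x} (p p' : Fin (suc (q ℕ.+ q))) → p ≢ p' → x ≡ -1ℤ → x ≡ + suc (suc (q ℕ.+ q)) ℤ.* 𝟙 (does (p Fin.≟ p')) ℤ.- 1ℤ
    off-diagonal p p' p≢p' refl rewrite dec-false (p Fin.≟ p') p≢p' | ℤ.*-zeroʳ (+ suc (suc (q ℕ.+ q))) = refl

    diagonal : ∀ {x} i j (embed : Fin q → Fin (suc (q ℕ.+ q))) → (∀ {i j} → embed i ≡ embed j → i ≡ j) →
      x ≡ + suc (suc (q ℕ.+ q)) ℤ.* δ i j ℤ.- 1ℤ →
      x ≡ + suc (suc (q ℕ.+ q)) ℤ.* 𝟙 (does (embed i Fin.≟ embed j)) ℤ.- 1ℤ
    diagonal i j embed embed-injective x≡ = trans x≡ (cong (λ d → + suc (suc (q ℕ.+ q)) ℤ.* d ℤ.- 1ℤ) (δ≡𝟙 embed-injective))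
      where
      δ≡𝟙 : (∀ {i j} → embed i ≡ embed j → i ≡ j) → δ i j ≡ 𝟙 (does (embed i Fin.≟ embed j))
      δ≡𝟙 injective with i ≟F j
      ... | yes refl = sym (cong 𝟙 (dec-true (embed i Fin.≟ embed i) refl))
      ... | no i≢j   = sym (cong 𝟙 (dec-false (embed i Fin.≟ embed j) (i≢j ∘ injective)))

  block-gram : ∀ {p p'} (v : Position p) (v' : Position p') →
    block-row-product v v' ≡ + suc (suc (q ℕ.+ q)) ℤ.* 𝟙 (does (p Fin.≟ p')) ℤ.- 1ℤ
  block-gram apex apex = trans block-gram-apex-apex (sym (cong (ℤ._- 1ℤ) (ℤ.*-identityʳ (+ suc (suc (q ℕ.+ q))))))
  block-gram apex (first j) = off-diagonal zero (suc (j ↑ˡ q)) (λ ()) (block-gram-apex-first j)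
  block-gram apex (second j) = off-diagonal zero (suc (q ↑ʳ j)) (λ ()) (block-gram-apex-second j)
  block-gram (first i) apex = off-diagonal (suc (i ↑ˡ q)) zero (λ ()) (trans (block-row-product-comm (first i) apex) (block-gram-apex-first i))
  block-gram (second i) apex = off-diagonal (suc (q ↑ʳ i)) zero (λ ()) (trans (block-row-product-comm (second i) apex) (block-gram-apex-second i))
  block-gram (first i) (second j) = off-diagonal (suc (i ↑ˡ q)) (suc (q ↑ʳ j)) (first≢second i j) (block-gram-first-second i j)
  block-gram (second i) (first j) = off-diagonal (suc (q ↑ʳ i)) (suc (j ↑ˡ q)) (first≢second j i ∘ sym)
    (trans (block-row-product-comm (second i) (first j)) (block-gram-first-second j i))
  block-gram (first i) (first j) = diagonal i j (λ i → suc (i ↑ˡ q)) (↑ˡ-injective q _ _ ∘ suc-injective) (block-gram-first-first i j)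
  block-gram (second i) (second j) = diagonal i j (λ i → suc (q ↑ʳ i)) (↑ʳ-injective q _ _ ∘ suc-injective) (block-gram-second-second i j)

  N'-gram : ∀ p p' → sum (λ b → N' p b ℤ.* N' p' b) ≡ + suc (suc (q ℕ.+ q)) ℤ.* 𝟙 (does (p Fin.≟ p')) ℤ.- 1ℤ
  N'-gram p p' = trans (N'-row-product-blocks (position p) (position p')) (block-gram (position p) (position p'))

open HadamardMatrices
open import Data.Nat using (ℕ; _*_; _∸_)
open import Data.Fin using (Fin)
open import Data.Fin.Subset using (Subset)
open import Data.Integer using (ℤ)
open import Data.List using (_∷_; [])
open import Data.Product using (Σ; _×_)

open import Data.Fin.Subset using (_∩_; ∣_∣)
open import Data.List.Relation.Unary.Any using (here; there)
open import Data.Nat using (suc; _+_)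
open import Data.Nat.Properties using (+-suc; suc-pred)
open import Data.Nat.Tactic.RingSolver using (solve-∀)
open import Data.Product using (_,_)
open import Data.Sum using (_⊎_; inj₁; inj₂)
open import Relation.Binary.PropositionalEquality using (_≡_; refl; cong; cong₂; subst; module ≡-Reasoning)

private
  2m²≡2+4t : ∀ k → let t = 2 * (k * k + k) in 2 * suc (2 * k) * suc (2 * k) ≡ 2 + ((t + t) + (t + t))
  2m²≡2+4t = solve-∀

  2m²+2m²≡4m² : ∀ m → 2 * m * m + 2 * m * m ≡ 4 * m * m
  2m²+2m²≡4m² = solve-∀

proposition6p3 : (m : ℕ) → Odd m → IsPrimePower (2 * m * m ∸ 1)
    → (F : FiniteField (2 * m * m ∸ 1))
    → (D : Subset _)
    → IsIntersectionSet (FiniteField.block F) D (2 * m * m ∸ m) (m * m ∸ m ∷ m * m ∷ [])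
    → Σ (Fin (4 * m * m) → Fin (4 * m * m) → ℤ) λ H → IsRegularHadamard (4 * m * m) H
proposition6p3 .(suc (2 * k)) (k , refl) _ F D (∣D∣ , intersections , _) =
  subst (λ n → Σ (Fin n → Fin n → ℤ) (IsRegularHadamard n)) order
    (regular-from-two-intersection-set N' N'-sign N'-symmetric N'-row-sum N'-gram m D order ∣D∣ intersection-sizes)
  where
  m t q : ℕ
  m = suc (2 * k)
  t = 2 * (k * k + k)
  q = 2 * m * m ∸ 1
  q≡1+4t : q ≡ suc ((t + t) + (t + t))
  q≡1+4t = cong (_∸ 1) (2m²≡2+4t k)
  order : 2 + (q + q) ≡ 4 * m * m
  order = begin
    2 + (q + q)               ≡⟨ cong suc (+-suc q q) ⟨
    suc q + suc q             ≡⟨ cong₂ _+_ (suc-pred (2 * m * m)) (suc-pred (2 * m * m)) ⟩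
    2 * m * m + 2 * m * m     ≡⟨ 2m²+2m²≡4m² m ⟩
    4 * m * m                 ∎
    where open ≡-Reasoning
  open FiniteField F using (N'; block)
  open PaleyMatrix F t q≡1+4t
  intersection-sizes : ∀ p → ∣ block p ∩ D ∣ ≡ m * m ∸ m ⊎ ∣ block p ∩ D ∣ ≡ m * m
  intersection-sizes p with intersections p
  ... | here x≡m²-m       = inj₁ x≡m²-m
  ... | there (here x≡m²) = inj₂ x≡m²
  ... | there (there ())
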